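{- Let $G=\bigoplus_{t=1}^r \mathbb{Z}_{k_t}$ with each $k_t\ge 2$, and write $|G|=\prod_{t=1}^r k_t$. For each $j\in\{1,2,\ldots\}$ let $S_j=\prod_{t=1}^r S_{t,j}\subseteq G$, where each $S_{t,j}$ is a given subset of $\mathbb{Z}_{k_t}=\{0,1,\ldots,k_t-1\}$. For ${\bf s}\in G$ let $c({\bf s};S_1,\ldots,S_m)$ be the number of $m$-tuples $({\bf x}_1,\ldots,{\bf x}_m)$ with ${\bf x}_j\in S_j$ for each $1\le j\le m$ and ${\bf x}_1+\cdots+{\bf x}_m={\bf s}$ in $G$. Assume that for all $1\le t\le r$ and all $j\ge 1$, $$\gcd\{a-b:\ a,b\in S_{t,j}\}=1,$$ where elements of $\mathbb{Z}_{k_t}$ are regarded as integers in $\{0,\ldots,k_t-1\}$. Then there is a constant $0<\theta<1$, independent of $m$, such that as $m\to\infty$, $$c({\bf s};S_1,\ldots,S_m)=\frac{1}{|G|}\Big(\prod_{j=1}^m|S_j|\Big)\big(1+O(\theta^m)\big).$$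
   Context: Addition in $G$ is componentwise, modulo $k_t$ in the $t$-th coordinate. Such a tuple is called an $m$-composition of ${\bf s}$ over $G$ whose $j$-th part lies in $S_j$. -}

module Defs where

open import Data.Nat as ℕ using (ℕ; zero; suc; _%_)
open import Data.Nat.GCD using (gcd)
open import Data.Fin as Fin using (Fin; toℕ)
open import Data.Fin.Subset using (Subset; _∈_)
open import Data.Fin.Subset.Properties using (_∈?_)
open import Data.Fin.Properties using (all?)
open import Data.List as List using (List; []; _∷_; [_]; map; concatMap; filter; length; allFin; foldr)
open import Data.Vec as Vec using (Vec; []; _∷_)
open import Data.Product using (_×_; _,_)
open import Data.Empty using (⊥)
open import Data.Unit using (⊤)
open import Relation.Nullary using (Dec; yes; no)
open import Relation.Nullary.Decidable using (_×-dec_)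
open import Relation.Binary.PropositionalEquality using (_≡_)
open import Data.Rational as ℚ using (ℚ; 1ℚ; _*_)

G : (r : ℕ) → (Fin r → ℕ) → Set
G r k = (t : Fin r) → Fin (k t)

consG : ∀ {r} {k : Fin (suc r) → ℕ} → Fin (k Fin.zero) → G r (λ t → k (Fin.suc t)) → G (suc r) k
consG a g Fin.zero = a
consG a g (Fin.suc t) = g t

allG : (r : ℕ) (k : Fin r → ℕ) → List (G r k)
allG zero k = [ (λ ()) ]
allG (suc r) k = concatMap (λ a → map (consG {r} {k} a) (allG r (λ t → k (Fin.suc t)))) (allFin (k Fin.zero))

allTuples : (r : ℕ) (k : Fin r → ℕ) (m : ℕ) → List (Vec (G r k) m)
allTuples r k zero = [ [] ]
allTuples r k (suc m) = concatMap (λ x → map (x ∷_) (allTuples r k m)) (allG r k)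

InBox : ∀ {r k} → ((t : Fin r) → Subset (k t)) → G r k → Set
InBox S x = ∀ t → x t ∈ S t

inBox? : ∀ {r k} (S : (t : Fin r) → Subset (k t)) (x : G r k) → Dec (InBox S x)
inBox? S x = all? (λ t → x t ∈? S t)

ModEq : (n : ℕ) → ℕ → Fin n → Set
ModEq zero a ()
ModEq (suc n) a b = a % suc n ≡ toℕ b

modEq? : (n : ℕ) (a : ℕ) (b : Fin n) → Dec (ModEq n a b)
modEq? zero a ()
modEq? (suc n) a b = (a % suc n) ℕ.≟ toℕ b

coordSum : ∀ {r k m} → Vec (G r k) m → Fin r → ℕ
coordSum [] t = 0
coordSum (x ∷ xs) t = toℕ (x t) ℕ.+ coordSum xs t

SumsTo : ∀ {r k m} → Vec (G r k) m → G r k → Set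
SumsTo {k = k} xs s = ∀ t → ModEq (k t) (coordSum xs t) (s t)

sumsTo? : ∀ {r k m} (xs : Vec (G r k) m) (s : G r k) → Dec (SumsTo xs s)
sumsTo? {k = k} xs s = all? (λ t → modEq? (k t) (coordSum xs t) (s t))

-- x_j ∈ S_j for all 1 ≤ j ≤ m (the vector position i : Fin m is the paper's j = i + 1)
AllIn : ∀ {r k m} → (ℕ → (t : Fin r) → Subset (k t)) → Vec (G r k) m → Set
AllIn S [] = ⊤
AllIn S (x ∷ xs) = InBox (S 1) x × AllIn (λ j → S (suc j)) xs

allIn? : ∀ {r k m} (S : ℕ → (t : Fin r) → Subset (k t)) (xs : Vec (G r k) m) → Dec (AllIn S xs)
allIn? S [] = yes Data.Unit.tt
allIn? S (x ∷ xs) = inBox? (S 1) x ×-dec allIn? (λ j → S (suc j)) xs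

count : (r : ℕ) (k : Fin r → ℕ) (S : ℕ → (t : Fin r) → Subset (k t)) (m : ℕ) (s : G r k) → ℕ
count r k S m s = length (filter (λ xs → allIn? S xs ×-dec sumsTo? xs s) (allTuples r k m))

boxSize : (r : ℕ) (k : Fin r → ℕ) → ((t : Fin r) → Subset (k t)) → ℕ
boxSize r k S = length (filter (inBox? S) (allG r k))

prodFin : (r : ℕ) → (Fin r → ℕ) → ℕ
prodFin zero f = 1
prodFin (suc r) f = f Fin.zero ℕ.* prodFin r (λ t → f (Fin.suc t))

prodTo : ℕ → (ℕ → ℕ) → ℕ
prodTo zero f = 1
prodTo (suc m) f = prodTo m f ℕ.* f (suc m)

elems : ∀ {n} → Subset n → List ℕ
elems {n} A = map toℕ (filter (_∈? A) (allFin n))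

-- gcd{ a - b : a, b ∈ A } (gcd of the absolute values; gcd of the empty set is 0)
gcdDiffs : ∀ {n} → Subset n → ℕ
gcdDiffs A = foldr gcd 0 (concatMap (λ a → map (λ b → ℕ.∣ a - b ∣) (elems A)) (elems A))

_^ℚ_ : ℚ → ℕ → ℚ
q ^ℚ zero = 1ℚ
q ^ℚ suc n = q * (q ^ℚ n)

module Submission where

-- Take blocks of L = |G| consecutive summands. Since L ≥ k_t and the differences of each S_{t,j} have
-- gcd 1, the sumsets (S_{t,1} − b₁) + ⋯ + (S_{t,j} − b_j) in ℤ_{k_t} grow strictly until they are
-- everything, so every s ∈ G is a sum x₁ + ⋯ + x_L with x_j ∈ S_j. Splitting off the first block,
-- c(s; S₁, …, S_{L+m}) is a sum over the N admissible blocks u of c(s − Σu; S_{L+1}, …), and the block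
-- with Σu = s contributes c(0; S_{L+1}, …) whatever s is. Hence if the shifted counts lie in an interval
-- of width D, the new ones lie in an interval of width (N − 1) D, while the total mass is multiplied
-- by N ≤ |G|^L. Per block the relative width shrinks by (N − 1)/N, which a Bernoulli-type inequality
-- bounds by θ^L with θ = P/(1 + P), P = |G|^L L. Since the counts over all s add up to ∏ |S_j|,
-- each one is within the width of the mean ∏ |S_j| / |G|.

module Counting where

  open import Data.Nat using (ℕ; zero; suc; _+_; _*_; _≤_; _<_; z≤n; s≤s)
  open import Data.Nat.Properties
  open import Data.List using (List; []; _∷_; map; concatMap; filter; length; _++_; allFin)
  open import Data.List.Properties using (length-tabulate; filter-≐; filter-none; filter-++; length-++)
  open import Data.List.Membership.Propositional using (_∈_)
  open import Data.List.Relation.Unary.Any using (Any; here; there)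
  import Data.List.Relation.Unary.All as All
  open import Relation.Nullary using (yes; no; ¬_)
  open import Relation.Unary using (Decidable; _≐_)
  open import Relation.Binary.PropositionalEquality
  open import Data.Empty using (⊥-elim)
  open import Data.Product using (_×_; _,_)
  open import Function using (id; _∘_)
  open import Algebra.Properties.CommutativeSemigroup +-commutativeSemigroup using (interchange; xy∙z≈x∙zy; x∙yz≈y∙xz)

  #filter : {A : Set} {P : A → Set} → Decidable P → List A → ℕ
  #filter P? xs = length (filter P? xs)

  length-allFin : ∀ n → length (allFin n) ≡ n
  length-allFin n = length-tabulate id

  sumBy : {A : Set} → (A → ℕ) → List A → ℕ
  sumBy f [] = 0
  sumBy f (x ∷ xs) = f x + sumBy f xs

  sumTo : ℕ → (ℕ → ℕ) → ℕ
  sumTo zero f = 0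
  sumTo (suc j) f = sumTo j f + f j

  sumTo-cong : ∀ j {f g : ℕ → ℕ} → (∀ i → i < j → f i ≡ g i) → sumTo j f ≡ sumTo j g
  sumTo-cong zero f≗g = refl
  sumTo-cong (suc j) f≗g = cong₂ _+_ (sumTo-cong j (λ i i<j → f≗g i (m≤n⇒m≤1+n i<j))) (f≗g j ≤-refl)

  sumTo-suc : ∀ j (f : ℕ → ℕ) → sumTo (suc j) f ≡ f 0 + sumTo j (f ∘ suc)
  sumTo-suc zero f = +-comm 0 (f 0)
  sumTo-suc (suc j) f = trans (cong (_+ f (suc j)) (sumTo-suc j f)) (+-assoc (f 0) _ _)

  module _ {A : Set} {P : A → Set} (P? : Decidable P) where

    #filter-++ : (xs ys : List A) → #filter P? (xs ++ ys) ≡ #filter P? xs + #filter P? ys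
    #filter-++ xs ys = trans (cong length (filter-++ P? xs ys)) (length-++ (filter P? xs))

    #filter-none : (∀ x → ¬ P x) → ∀ xs → #filter P? xs ≡ 0
    #filter-none ¬P xs = cong length (filter-none P? (All.universal ¬P xs))

    #filter-pos : ∀ {xs} → Any P xs → 1 ≤ #filter P? xs
    #filter-pos {x ∷ xs} Pxs with P? x | Pxs
    ... | yes _ | _          = s≤s z≤n
    ... | no ¬p | here p     = ⊥-elim (¬p p)
    ... | no _  | there Pxs′ = #filter-pos Pxs′

    #filter-as-sumBy : (xs : List A) → #filter P? xs ≡ sumBy (λ x → #filter P? (x ∷ [])) xs
    #filter-as-sumBy [] = refl
    #filter-as-sumBy (x ∷ xs) = trans (#filter-++ (x ∷ []) xs) (cong (#filter P? (x ∷ []) +_) (#filter-as-sumBy xs))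

    sumBy-indicator : (f : A → ℕ) (K : ℕ) → (∀ x → P x → f x ≡ K) → (∀ x → ¬ P x → f x ≡ 0) →
      ∀ xs → sumBy f xs ≡ #filter P? xs * K
    sumBy-indicator f K onP offP [] = refl
    sumBy-indicator f K onP offP (x ∷ xs) with P? x
    ... | yes p = cong₂ _+_ (onP x p) (sumBy-indicator f K onP offP xs)
    ... | no ¬p = cong₂ _+_ (offP x ¬p) (sumBy-indicator f K onP offP xs)

  module _ {A : Set} {P Q : A → Set} (P? : Decidable P) (Q? : Decidable Q) where

    #filter-≐ : P ≐ Q → ∀ xs → #filter P? xs ≡ #filter Q? xs
    #filter-≐ P≐Q xs = cong length (filter-≐ P? Q? P≐Q xs)

    #filter-mono : (∀ {x} → P x → Q x) → ∀ xs → #filter P? xs ≤ #filter Q? xs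
    #filter-mono P⊆Q [] = z≤n
    #filter-mono P⊆Q (x ∷ xs) with P? x | Q? x
    ... | yes p | no ¬q = ⊥-elim (¬q (P⊆Q p))
    ... | yes p | yes q = s≤s (#filter-mono P⊆Q xs)
    ... | no ¬p | yes q = m≤n⇒m≤1+n (#filter-mono P⊆Q xs)
    ... | no ¬p | no ¬q = #filter-mono P⊆Q xs

    #filter-strictMono : (∀ {x} → P x → Q x) → ∀ {y xs} → y ∈ xs → Q y → ¬ P y → #filter P? xs < #filter Q? xs
    #filter-strictMono P⊆Q {xs = x ∷ xs} (here refl) qy ¬py with P? x | Q? x
    ... | yes p | _ = ⊥-elim (¬py p)
    ... | no ¬p | yes q = s≤s (#filter-mono P⊆Q xs)
    ... | no ¬p | no ¬q = ⊥-elim (¬q qy)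
    #filter-strictMono P⊆Q {xs = x ∷ xs} (there y∈xs) qy ¬py with P? x | Q? x
    ... | yes p | no ¬q = ⊥-elim (¬q (P⊆Q p))
    ... | yes p | yes q = s≤s (#filter-strictMono P⊆Q y∈xs qy ¬py)
    ... | no ¬p | yes q = m≤n⇒m≤1+n (#filter-strictMono P⊆Q y∈xs qy ¬py)
    ... | no ¬p | no ¬q = #filter-strictMono P⊆Q y∈xs qy ¬py

  module _ {A : Set} where

    sumBy-cong : {f g : A → ℕ} → (∀ x → f x ≡ g x) → ∀ xs → sumBy f xs ≡ sumBy g xs
    sumBy-cong f≗g [] = refl
    sumBy-cong f≗g (x ∷ xs) = cong₂ _+_ (f≗g x) (sumBy-cong f≗g xs)

    sumBy-++ : (f : A → ℕ) (xs ys : List A) → sumBy f (xs ++ ys) ≡ sumBy f xs + sumBy f ys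
    sumBy-++ f [] ys = refl
    sumBy-++ f (x ∷ xs) ys = trans (cong (f x +_) (sumBy-++ f xs ys)) (sym (+-assoc (f x) _ _))

    sumBy-+ : (f g : A → ℕ) (xs : List A) → sumBy (λ x → f x + g x) xs ≡ sumBy f xs + sumBy g xs
    sumBy-+ f g [] = refl
    sumBy-+ f g (x ∷ xs) = trans (cong (f x + g x +_) (sumBy-+ f g xs)) (interchange (f x) (g x) (sumBy f xs) (sumBy g xs))

    sumBy-const : (c : ℕ) (xs : List A) → sumBy (λ _ → c) xs ≡ length xs * c
    sumBy-const c [] = refl
    sumBy-const c (x ∷ xs) = cong (c +_) (sumBy-const c xs)

    length*≤sumBy : (f : A → ℕ) (a : ℕ) → (∀ x → a ≤ f x) → ∀ xs → length xs * a ≤ sumBy f xs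
    length*≤sumBy f a a≤f [] = z≤n
    length*≤sumBy f a a≤f (x ∷ xs) = +-mono-≤ (a≤f x) (length*≤sumBy f a a≤f xs)

    sumBy≤length* : (f : A → ℕ) (a : ℕ) → (∀ x → f x ≤ a) → ∀ xs → sumBy f xs ≤ length xs * a
    sumBy≤length* f a f≤a [] = z≤n
    sumBy≤length* f a f≤a (x ∷ xs) = +-mono-≤ (f≤a x) (sumBy≤length* f a f≤a xs)

  module _ {A B : Set} where

    #filter-map : {P : B → Set} (P? : Decidable P) (f : A → B) (xs : List A) → #filter P? (map f xs) ≡ #filter (λ x → P? (f x)) xs
    #filter-map P? f [] = refl
    #filter-map P? f (x ∷ xs) with P? (f x)
    ... | yes p = cong suc (#filter-map P? f xs)
    ... | no ¬p = #filter-map P? f xs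

    sumBy-map : (F : B → ℕ) (f : A → B) (xs : List A) → sumBy F (map f xs) ≡ sumBy (λ x → F (f x)) xs
    sumBy-map F f [] = refl
    sumBy-map F f (x ∷ xs) = cong (F (f x) +_) (sumBy-map F f xs)

    #filter-concatMap : {P : B → Set} (P? : Decidable P) (f : A → List B) (xs : List A) →
      #filter P? (concatMap f xs) ≡ sumBy (λ x → #filter P? (f x)) xs
    #filter-concatMap P? f [] = refl
    #filter-concatMap P? f (x ∷ xs) = trans (#filter-++ P? (f x) (concatMap f xs)) (cong (#filter P? (f x) +_) (#filter-concatMap P? f xs))

    sumBy-concatMap : (F : B → ℕ) (f : A → List B) (xs : List A) →
      sumBy F (concatMap f xs) ≡ sumBy (λ x → sumBy F (f x)) xs
    sumBy-concatMap F f [] = refl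
    sumBy-concatMap F f (x ∷ xs) = trans (sumBy-++ F (f x) (concatMap f xs)) (cong (sumBy F (f x) +_) (sumBy-concatMap F f xs))

    length-concatMap : (f : A → List B) (xs : List A) → length (concatMap f xs) ≡ sumBy (λ x → length (f x)) xs
    length-concatMap f [] = refl
    length-concatMap f (x ∷ xs) = trans (length-++ (f x)) (cong (length (f x) +_) (length-concatMap f xs))

    sumBy-swap : (F : A → B → ℕ) (xs : List A) (ys : List B) →
      sumBy (λ x → sumBy (F x) ys) xs ≡ sumBy (λ y → sumBy (λ x → F x y) xs) ys
    sumBy-swap F [] ys = sym (trans (sumBy-const 0 ys) (*-zeroʳ (length ys)))
    sumBy-swap F (x ∷ xs) ys =
      trans (cong (sumBy (F x) ys +_) (sumBy-swap F xs ys)) (sym (sumBy-+ (F x) (λ y → sumBy (λ x′ → F x′ y) xs) ys))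

    #filter-singleton-cong : {P : A → Set} {Q : B → Set} (P? : Decidable P) (Q? : Decidable Q) {x : A} {y : B} →
      (P x → Q y) → (Q y → P x) → #filter P? (x ∷ []) ≡ #filter Q? (y ∷ [])
    #filter-singleton-cong P? Q? {x} {y} to from with P? x | Q? y
    ... | yes p | yes q = refl
    ... | yes p | no ¬q = ⊥-elim (¬q (to p))
    ... | no ¬p | yes q = ⊥-elim (¬p (from q))
    ... | no ¬p | no ¬q = refl

  module _ {A : Set} {Q : A → Set} (Q? : Decidable Q) (F : A → ℕ) (h : ℕ) where
    open ≤-Reasoning

    sumBy≤#filter* : (∀ x → Q x → F x ≤ h) → (∀ x → ¬ Q x → F x ≡ 0) → ∀ xs → sumBy F xs ≤ #filter Q? xs * h
    sumBy≤#filter* F≤h F≡0 [] = z≤n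
    sumBy≤#filter* F≤h F≡0 (x ∷ xs) with Q? x
    ... | yes q = +-mono-≤ (F≤h x q) (sumBy≤#filter* F≤h F≡0 xs)
    ... | no ¬q = subst (_≤ _) (cong (_+ sumBy F xs) (sym (F≡0 x ¬q))) (sumBy≤#filter* F≤h F≡0 xs)

    #filter*≤sumBy : (∀ x → Q x → h ≤ F x) → ∀ xs → #filter Q? xs * h ≤ sumBy F xs
    #filter*≤sumBy h≤F [] = z≤n
    #filter*≤sumBy h≤F (x ∷ xs) with Q? x
    ... | yes q = +-mono-≤ (h≤F x q) (#filter*≤sumBy h≤F xs)
    ... | no ¬q = ≤-trans (#filter*≤sumBy h≤F xs) (m≤n+m (sumBy F xs) (F x))

    -- One Q-element is pinned to the value Z; the bounds are shifted by h so that no subtraction occurs.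
    sumBy-pinned-≤ : ∀ {Z} → (∀ x → Q x → F x ≤ h) → (∀ x → ¬ Q x → F x ≡ 0) →
      ∀ xs → Any (λ x → Q x × F x ≡ Z) xs → sumBy F xs + h ≤ Z + #filter Q? xs * h
    sumBy-pinned-≤ {Z} F≤h F≡0 (x ∷ xs) pinned with Q? x | pinned
    ... | no ¬q | here (q , _) = ⊥-elim (¬q q)
    ... | no ¬q | there pinned′ = begin
      F x + sumBy F xs + h ≡⟨ cong (λ v → v + sumBy F xs + h) (F≡0 x ¬q) ⟩
      sumBy F xs + h       ≤⟨ sumBy-pinned-≤ F≤h F≡0 xs pinned′ ⟩
      Z + #filter Q? xs * h ∎
    ... | yes q | here (_ , Fx≡Z) = begin
      F x + sumBy F xs + h      ≡⟨ cong (λ v → v + sumBy F xs + h) Fx≡Z ⟩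
      Z + sumBy F xs + h        ≡⟨ xy∙z≈x∙zy Z (sumBy F xs) h ⟩
      Z + (h + sumBy F xs)      ≤⟨ +-monoʳ-≤ Z (+-monoʳ-≤ h (sumBy≤#filter* F≤h F≡0 xs)) ⟩
      Z + (h + #filter Q? xs * h) ∎
    ... | yes q | there pinned′ = begin
      F x + sumBy F xs + h        ≡⟨ +-assoc (F x) (sumBy F xs) h ⟩
      F x + (sumBy F xs + h)      ≤⟨ +-mono-≤ (F≤h x q) (sumBy-pinned-≤ F≤h F≡0 xs pinned′) ⟩
      h + (Z + #filter Q? xs * h) ≡⟨ x∙yz≈y∙xz h Z (#filter Q? xs * h) ⟩
      Z + (h + #filter Q? xs * h) ∎

    sumBy-pinned-≥ : ∀ {Z} → (∀ x → Q x → h ≤ F x) →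
      ∀ xs → Any (λ x → Q x × F x ≡ Z) xs → Z + #filter Q? xs * h ≤ sumBy F xs + h
    sumBy-pinned-≥ {Z} h≤F (x ∷ xs) pinned with Q? x | pinned
    ... | no ¬q | here (q , _) = ⊥-elim (¬q q)
    ... | no ¬q | there pinned′ = begin
      Z + #filter Q? xs * h ≤⟨ sumBy-pinned-≥ h≤F xs pinned′ ⟩
      sumBy F xs + h        ≤⟨ m≤n+m (sumBy F xs + h) (F x) ⟩
      F x + (sumBy F xs + h) ≡⟨ +-assoc (F x) (sumBy F xs) h ⟨
      F x + sumBy F xs + h  ∎
    ... | yes q | here (_ , Fx≡Z) = begin
      Z + (h + #filter Q? xs * h) ≤⟨ +-monoʳ-≤ Z (+-monoʳ-≤ h (#filter*≤sumBy h≤F xs)) ⟩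
      Z + (h + sumBy F xs)        ≡⟨ xy∙z≈x∙zy Z (sumBy F xs) h ⟨
      Z + sumBy F xs + h          ≡⟨ cong (λ v → v + sumBy F xs + h) Fx≡Z ⟨
      F x + sumBy F xs + h        ∎
    ... | yes q | there pinned′ = begin
      Z + (h + #filter Q? xs * h) ≡⟨ x∙yz≈y∙xz h Z (#filter Q? xs * h) ⟨
      h + (Z + #filter Q? xs * h) ≤⟨ +-mono-≤ (h≤F x q) (sumBy-pinned-≥ h≤F xs pinned′) ⟩
      F x + (sumBy F xs + h)      ≡⟨ +-assoc (F x) (sumBy F xs) h ⟨
      F x + sumBy F xs + h        ∎

module Enumeration where

  open import Defs
  open Counting
  open import Data.Nat using (ℕ; zero; suc; _+_; _*_; _^_; _≤_; _<_; z≤n; s≤s; _≟_; _%_; >-nonZero)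
  open import Data.Nat.Properties
  open import Data.Nat.DivMod using (m%n<n)
  open import Data.Fin using (Fin; zero; suc; toℕ)
  open import Data.Fin.Properties using (all?)
  open import Data.Fin.Subset using (Subset; _∈_)
  open import Data.List using (List; []; _∷_; map; length; allFin)
  open import Data.List.Properties using (length-map; map-tabulate)
  open import Data.List.Relation.Unary.Any using (Any; here)
  import Data.List.Relation.Unary.Any as Any
  open import Data.List.Relation.Unary.Any.Properties using (concatMap⁺; map⁺; tabulate⁺)
  open import Data.Vec using (Vec; []; _∷_; _++_)
  open import Data.Vec.Relation.Binary.Pointwise.Inductive using (Pointwise; []; _∷_)
  open import Data.Product using (_×_; _,_; proj₁; proj₂)
  open import Data.Unit using (tt)
  open import Function using (id; _∘_)
  open import Relation.Nullary using (¬_)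
  open import Relation.Nullary.Decidable using (_×-dec_)
  open import Relation.Unary using (Decidable)
  open import Relation.Binary.PropositionalEquality

  allFin-suc : ∀ n → allFin (suc n) ≡ zero ∷ map suc (allFin n)
  allFin-suc n = cong (zero ∷_) (sym (map-tabulate id suc))

  length-allG : ∀ r (k : Fin r → ℕ) → length (allG r k) ≡ prodFin r k
  length-allG zero k = refl
  length-allG (suc r) k = begin
    length (allG (suc r) k)                                   ≡⟨ length-concatMap _ (allFin (k zero)) ⟩
    sumBy (λ a → length (map (consG {r} {k} a) (allG r (k ∘ suc)))) (allFin (k zero))
      ≡⟨ sumBy-cong (λ a → trans (length-map (consG {r} {k} a) (allG r (k ∘ suc))) (length-allG r (k ∘ suc))) (allFin (k zero)) ⟩
    sumBy (λ _ → prodFin r (k ∘ suc)) (allFin (k zero))        ≡⟨ sumBy-const (prodFin r (k ∘ suc)) (allFin (k zero)) ⟩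
    length (allFin (k zero)) * prodFin r (k ∘ suc)             ≡⟨ cong (_* prodFin r (k ∘ suc)) (length-allFin (k zero)) ⟩
    prodFin (suc r) k                                          ∎
    where open ≡-Reasoning

  length-allTuples : ∀ r (k : Fin r → ℕ) m → length (allTuples r k m) ≡ length (allG r k) ^ m
  length-allTuples r k zero = refl
  length-allTuples r k (suc m) = begin
    length (allTuples r k (suc m))                            ≡⟨ length-concatMap _ (allG r k) ⟩
    sumBy (λ x → length (map (x ∷_) (allTuples r k m))) (allG r k)
      ≡⟨ sumBy-cong (λ x → trans (length-map (x ∷_) (allTuples r k m)) (length-allTuples r k m)) (allG r k) ⟩
    sumBy (λ _ → length (allG r k) ^ m) (allG r k)            ≡⟨ sumBy-const _ (allG r k) ⟩
    length (allG r k) ^ suc m                                 ∎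
    where open ≡-Reasoning

  -- Elements of G are functions, so the enumerations are complete only up to pointwise equality.
  infix 4 _≋_

  _≋_ : ∀ {r} {k : Fin r → ℕ} → G r k → G r k → Set
  x ≋ y = ∀ t → x t ≡ y t

  allG-complete : ∀ r (k : Fin r → ℕ) (x : G r k) → Any (x ≋_) (allG r k)
  allG-complete zero k x = here (λ ())
  allG-complete (suc r) k x =
    concatMap⁺ _ (tabulate⁺ (x zero) (map⁺ (Any.map extend (allG-complete r (k ∘ suc) (x ∘ suc)))))
    where
    extend : ∀ {g} → x ∘ suc ≋ g → x ≋ consG {r} {k} (x zero) g
    extend _   zero    = refl
    extend x≋g (suc t) = x≋g t

  allTuples-complete : ∀ r (k : Fin r → ℕ) m (u : Vec (G r k) m) → Any (Pointwise _≋_ u) (allTuples r k m)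
  allTuples-complete r k zero [] = here []
  allTuples-complete r k (suc m) (x ∷ u) =
    concatMap⁺ _ (Any.map (λ x≋y → map⁺ (Any.map (x≋y ∷_) (allTuples-complete r k m u))) (allG-complete r k x))

  module _ {r : ℕ} {k : Fin r → ℕ} where

    coordSum-≋ : ∀ {m} {u v : Vec (G r k) m} → Pointwise _≋_ u v → ∀ t → coordSum u t ≡ coordSum v t
    coordSum-≋ [] t = refl
    coordSum-≋ (x≋y ∷ u≋v) t = cong₂ _+_ (cong toℕ (x≋y t)) (coordSum-≋ u≋v t)

    AllIn-≋ : ∀ {m} (S : ℕ → (t : Fin r) → Subset (k t)) {u v : Vec (G r k) m} → Pointwise _≋_ u v → AllIn S u → AllIn S v
    AllIn-≋ S [] tt = tt
    AllIn-≋ S (x≋y ∷ u≋v) (x∈ , u∈) = (λ t → subst (_∈ S 1 t) (x≋y t) (x∈ t)) , AllIn-≋ (S ∘ suc) u≋v u∈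

    SumsTo-≋ : ∀ {m} {u v : Vec (G r k) m} {s : G r k} → Pointwise _≋_ u v → SumsTo u s → SumsTo v s
    SumsTo-≋ {s = s} u≋v u↦s t = subst (λ z → ModEq (k t) z (s t)) (coordSum-≋ u≋v t) (u↦s t)

  ReducesTo : ∀ {r} (k : Fin r → ℕ) → (Fin r → ℕ) → G r k → Set
  ReducesTo k w s = ∀ t → ModEq (k t) (w t) (s t)

  reducesTo? : ∀ {r} (k : Fin r → ℕ) (w : Fin r → ℕ) → Decidable (ReducesTo k w)
  reducesTo? k w s = all? (λ t → modEq? (k t) (w t) (s t))

  #toℕ≡-allFin : ∀ {n} v → v < n → #filter (λ (b : Fin n) → v ≟ toℕ b) (allFin n) ≡ 1
  #toℕ≡-allFin {suc n} zero _ = begin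
    #filter P? (allFin (suc n))              ≡⟨ cong (#filter P?) (allFin-suc n) ⟩
    suc (#filter P? (map suc (allFin n)))    ≡⟨ cong suc (#filter-map P? suc (allFin n)) ⟩
    suc (#filter (P? ∘ suc) (allFin n))      ≡⟨ cong suc (#filter-none (P? ∘ suc) (λ _ ()) (allFin n)) ⟩
    1                                        ∎
    where
    open ≡-Reasoning
    P? : Decidable (λ (b : Fin (suc n)) → 0 ≡ toℕ b)
    P? b = 0 ≟ toℕ b
  #toℕ≡-allFin {suc n} (suc v) (s≤s v<n) = begin
    #filter P? (allFin (suc n))              ≡⟨ cong (#filter P?) (allFin-suc n) ⟩
    #filter P? (map suc (allFin n))          ≡⟨ #filter-map P? suc (allFin n) ⟩
    #filter (P? ∘ suc) (allFin n)            ≡⟨ #filter-≐ (P? ∘ suc) (λ b → v ≟ toℕ b) (suc-injective , cong suc) (allFin n) ⟩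
    #filter (λ b → v ≟ toℕ b) (allFin n)     ≡⟨ #toℕ≡-allFin v v<n ⟩
    1                                        ∎
    where
    open ≡-Reasoning
    P? : Decidable (λ (b : Fin (suc n)) → suc v ≡ toℕ b)
    P? b = suc v ≟ toℕ b

  #ReducesTo-allG : ∀ r (k : Fin r → ℕ) → (∀ t → 1 ≤ k t) → ∀ w → #filter (reducesTo? k w) (allG r k) ≡ 1
  #ReducesTo-allG zero k _ w = refl
  #ReducesTo-allG (suc r) k k≥1 w = begin
    #filter (reducesTo? k w) (allG (suc r) k)                                  ≡⟨ #filter-concatMap (reducesTo? k w) _ (allFin (k zero)) ⟩
    sumBy (λ a → #filter (reducesTo? k w) (map (consG {r} {k} a) rest)) (allFin (k zero))
      ≡⟨ sumBy-cong (λ a → #filter-map (reducesTo? k w) (consG {r} {k} a) rest) (allFin (k zero)) ⟩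
    sumBy (λ a → #filter (reducesTo? k w ∘ consG {r} {k} a) rest) (allFin (k zero))
      ≡⟨ sumBy-indicator (modEq? (k zero) (w zero)) _ 1 onHead offHead (allFin (k zero)) ⟩
    #filter (modEq? (k zero) (w zero)) (allFin (k zero)) * 1                  ≡⟨ cong (_* 1) (#modEq-allFin (k zero) (k≥1 zero)) ⟩
    1                                                                          ∎
    where
    open ≡-Reasoning
    rest : List (G r (k ∘ suc))
    rest = allG r (k ∘ suc)
    #modEq-allFin : ∀ n → 1 ≤ n → #filter (modEq? n (w zero)) (allFin n) ≡ 1
    #modEq-allFin (suc n) _ = #toℕ≡-allFin (w zero % suc n) (m%n<n (w zero) (suc n))
    onHead : ∀ a → ModEq (k zero) (w zero) a → #filter (reducesTo? k w ∘ consG {r} {k} a) rest ≡ 1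
    onHead a w₀↦a = trans
      (#filter-≐ _ (reducesTo? (k ∘ suc) (w ∘ suc)) ((λ w↦ t → w↦ (suc t)) , λ { w↦ zero → w₀↦a ; w↦ (suc t) → w↦ t }) rest)
                          (#ReducesTo-allG r (k ∘ suc) (k≥1 ∘ suc) (w ∘ suc))
    offHead : ∀ a → ¬ ModEq (k zero) (w zero) a → #filter (reducesTo? k w ∘ consG {r} {k} a) rest ≡ 0
    offHead a w₀↛a = #filter-none _ (λ g w↦ → w₀↛a (w↦ zero)) rest

  module _ (r : ℕ) (k : Fin r → ℕ) where

    #AllIn : (ℕ → (t : Fin r) → Subset (k t)) → ℕ → ℕ
    #AllIn S m = #filter (allIn? S) (allTuples r k m)

    prodTo-suc : ∀ m (f : ℕ → ℕ) → prodTo (suc m) f ≡ f 1 * prodTo m (f ∘ suc)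
    prodTo-suc zero f = *-comm 1 (f 1)
    prodTo-suc (suc m) f = trans (cong (_* f (suc (suc m))) (prodTo-suc m f)) (*-assoc (f 1) _ _)

    #AllIn≡prodTo : ∀ m (S : ℕ → (t : Fin r) → Subset (k t)) → #AllIn S m ≡ prodTo m (λ j → boxSize r k (S j))
    #AllIn≡prodTo zero S = refl
    #AllIn≡prodTo (suc m) S = begin
      #AllIn S (suc m)
        ≡⟨ #filter-concatMap (allIn? S) (λ x → map (x ∷_) (allTuples r k m)) (allG r k) ⟩
      sumBy (λ x → #filter (allIn? S) (map (x ∷_) (allTuples r k m))) (allG r k)
        ≡⟨ sumBy-cong (λ x → #filter-map (allIn? S) (x ∷_) (allTuples r k m)) (allG r k) ⟩
      sumBy (λ x → #filter (λ xs → allIn? S (x ∷ xs)) (allTuples r k m)) (allG r k)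
        ≡⟨ sumBy-indicator (inBox? (S 1)) _ (#AllIn (S ∘ suc) m) inS₁ notInS₁ (allG r k) ⟩
      boxSize r k (S 1) * #AllIn (S ∘ suc) m                     ≡⟨ cong (boxSize r k (S 1) *_) (#AllIn≡prodTo m (S ∘ suc)) ⟩
      boxSize r k (S 1) * prodTo m (λ j → boxSize r k (S (suc j))) ≡⟨ prodTo-suc m (λ j → boxSize r k (S j)) ⟨
      prodTo (suc m) (λ j → boxSize r k (S j))                   ∎
      where
      open ≡-Reasoning
      inS₁ : ∀ x → InBox (S 1) x → #filter (λ xs → allIn? S (x ∷ xs)) (allTuples r k m) ≡ #AllIn (S ∘ suc) m
      inS₁ x x∈ = #filter-≐ _ (allIn? (S ∘ suc)) (proj₂ , (x∈ ,_)) (allTuples r k m)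
      notInS₁ : ∀ x → ¬ InBox (S 1) x → #filter (λ xs → allIn? S (x ∷ xs)) (allTuples r k m) ≡ 0
      notInS₁ x x∉ = #filter-none _ (λ _ → x∉ ∘ proj₁) (allTuples r k m)

    -- Every tuple in the boxes sums to exactly one s ∈ G.
    sumBy-count≡#AllIn : (∀ t → 1 ≤ k t) → ∀ m (S : ℕ → (t : Fin r) → Subset (k t)) →
      sumBy (count r k S m) (allG r k) ≡ #AllIn S m
    sumBy-count≡#AllIn k≥1 m S = begin
      sumBy (count r k S m) (allG r k)
        ≡⟨ sumBy-cong (λ s → #filter-as-sumBy (solves? s) (allTuples r k m)) (allG r k) ⟩
      sumBy (λ s → sumBy (λ xs → #filter (solves? s) (xs ∷ [])) (allTuples r k m)) (allG r k)
        ≡⟨ sumBy-swap (λ s xs → #filter (solves? s) (xs ∷ [])) (allG r k) (allTuples r k m) ⟩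
      sumBy (λ xs → sumBy (λ s → #filter (solves? s) (xs ∷ [])) (allG r k)) (allTuples r k m)
        ≡⟨ sumBy-cong (λ xs → trans (sumBy-cong (λ s → #filter-singleton-cong (solves? s) (solutionOf? xs) id id) (allG r k))
                                    (sym (#filter-as-sumBy (solutionOf? xs) (allG r k)))) (allTuples r k m) ⟩
      sumBy (λ xs → #filter (solutionOf? xs) (allG r k)) (allTuples r k m)
        ≡⟨ sumBy-indicator (allIn? S) _ 1 inBoxes notInBoxes (allTuples r k m) ⟩
      #AllIn S m * 1                                            ≡⟨ *-identityʳ _ ⟩
      #AllIn S m                                                ∎
      where
      open ≡-Reasoning
      solves? : (s : G r k) → Decidable (λ xs → AllIn S xs × SumsTo {m = m} xs s)
      solves? s xs = allIn? S xs ×-dec sumsTo? xs s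
      solutionOf? : (xs : Vec (G r k) m) → Decidable (λ s → AllIn S xs × SumsTo xs s)
      solutionOf? xs s = allIn? S xs ×-dec sumsTo? xs s
      inBoxes : ∀ xs → AllIn S xs → #filter (solutionOf? xs) (allG r k) ≡ 1
      inBoxes xs xs∈ = trans (#filter-≐ (solutionOf? xs) (reducesTo? k (coordSum xs)) (proj₂ , (xs∈ ,_)) (allG r k))
                             (#ReducesTo-allG r k k≥1 (coordSum xs))
      notInBoxes : ∀ xs → ¬ AllIn S xs → #filter (solutionOf? xs) (allG r k) ≡ 0
      notInBoxes xs xs∉ = #filter-none (solutionOf? xs) (λ _ → xs∉ ∘ proj₁) (allG r k)

    #filter-allTuples-++ : ∀ L m {Q : Vec (G r k) (L + m) → Set} (Q? : Decidable Q) →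
      #filter Q? (allTuples r k (L + m)) ≡ sumBy (λ u → #filter (λ v → Q? (u ++ v)) (allTuples r k m)) (allTuples r k L)
    #filter-allTuples-++ zero m Q? = sym (+-identityʳ _)
    #filter-allTuples-++ (suc L) m Q? = begin
      #filter Q? (allTuples r k (suc L + m))
        ≡⟨ #filter-concatMap Q? (λ x → map (x ∷_) (allTuples r k (L + m))) (allG r k) ⟩
      sumBy (λ x → #filter Q? (map (x ∷_) (allTuples r k (L + m)))) (allG r k)
        ≡⟨ sumBy-cong (λ x → trans (#filter-map Q? (x ∷_) (allTuples r k (L + m))) (#filter-allTuples-++ L m (Q? ∘ (x ∷_)))) (allG r k) ⟩
      sumBy (λ x → sumBy (F ∘ (x ∷_)) (allTuples r k L)) (allG r k)
        ≡⟨ sumBy-cong (λ x → sym (sumBy-map F (x ∷_) (allTuples r k L))) (allG r k) ⟩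
      sumBy (λ x → sumBy F (map (x ∷_) (allTuples r k L))) (allG r k)
        ≡⟨ sumBy-concatMap F (λ x → map (x ∷_) (allTuples r k L)) (allG r k) ⟨
      sumBy F (allTuples r k (suc L))                           ∎
      where
      open ≡-Reasoning
      F : Vec (G r k) (suc L) → ℕ
      F u = #filter (λ v → Q? (u ++ v)) (allTuples r k m)

    coordSum-++ : ∀ {L m} (u : Vec (G r k) L) (v : Vec (G r k) m) t → coordSum (u ++ v) t ≡ coordSum u t + coordSum v t
    coordSum-++ [] v t = refl
    coordSum-++ (x ∷ u) v t = trans (cong (toℕ (x t) +_) (coordSum-++ u v t)) (sym (+-assoc (toℕ (x t)) _ _))

    AllIn-++⁻ : ∀ {L m} (S : ℕ → (t : Fin r) → Subset (k t)) (u : Vec (G r k) L) (v : Vec (G r k) m) →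
      AllIn S (u ++ v) → AllIn S u × AllIn (λ j → S (L + j)) v
    AllIn-++⁻ S [] v v∈ = tt , v∈
    AllIn-++⁻ S (x ∷ u) v (x∈ , uv∈) with AllIn-++⁻ (S ∘ suc) u v uv∈
    ... | u∈ , v∈ = (x∈ , u∈) , v∈

    AllIn-++⁺ : ∀ {L m} (S : ℕ → (t : Fin r) → Subset (k t)) (u : Vec (G r k) L) (v : Vec (G r k) m) →
      AllIn S u → AllIn (λ j → S (L + j)) v → AllIn S (u ++ v)
    AllIn-++⁺ S [] v u∈ v∈ = v∈
    AllIn-++⁺ S (x ∷ u) v (x∈ , u∈) v∈ = x∈ , AllIn-++⁺ (S ∘ suc) u v u∈ v∈

    #AllIn-+ : ∀ L m (S : ℕ → (t : Fin r) → Subset (k t)) → #AllIn S (L + m) ≡ #AllIn S L * #AllIn (λ j → S (L + j)) m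
    #AllIn-+ L m S = trans (#filter-allTuples-++ L m (allIn? S))
      (sumBy-indicator (allIn? S) _ (#AllIn (λ j → S (L + j)) m)
        (λ u u∈ → #filter-≐ _ (allIn? (λ j → S (L + j)))
                    ((λ {v} → proj₂ ∘ AllIn-++⁻ S u v) , AllIn-++⁺ S u _ u∈) (allTuples r k m))
        (λ u u∉ → #filter-none _ (λ v → u∉ ∘ proj₁ ∘ AllIn-++⁻ S u v) (allTuples r k m))
        (allTuples r k L))

  prodFin-pos : ∀ r (k : Fin r → ℕ) → (∀ t → 1 ≤ k t) → 1 ≤ prodFin r k
  prodFin-pos zero k k≥1 = ≤-refl
  prodFin-pos (suc r) k k≥1 = *-mono-≤ (k≥1 zero) (prodFin-pos r (k ∘ suc) (k≥1 ∘ suc))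

  k≤prodFin : ∀ r (k : Fin r → ℕ) → (∀ t → 1 ≤ k t) → ∀ t → k t ≤ prodFin r k
  k≤prodFin (suc r) k k≥1 zero = begin
    k zero                          ≡⟨ *-identityʳ (k zero) ⟨
    k zero * 1                      ≤⟨ *-monoʳ-≤ (k zero) (prodFin-pos r (k ∘ suc) (k≥1 ∘ suc)) ⟩
    k zero * prodFin r (k ∘ suc)    ∎
    where open ≤-Reasoning
  k≤prodFin (suc r) k k≥1 (suc t) = begin
    k (suc t)                       ≤⟨ k≤prodFin r (k ∘ suc) (k≥1 ∘ suc) t ⟩
    prodFin r (k ∘ suc)             ≤⟨ m≤n*m (prodFin r (k ∘ suc)) (k zero) {{>-nonZero (k≥1 zero)}} ⟩
    k zero * prodFin r (k ∘ suc)    ∎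
    where open ≤-Reasoning

  prefix : ∀ {r} {k : Fin r → ℕ} → (ℕ → G r k) → (L : ℕ) → Vec (G r k) L
  prefix f zero = []
  prefix f (suc L) = f 0 ∷ prefix (f ∘ suc) L

  coordSum-prefix : ∀ {r} {k : Fin r → ℕ} (f : ℕ → G r k) L t → coordSum (prefix f L) t ≡ sumTo L (λ i → toℕ (f i t))
  coordSum-prefix f zero t = refl
  coordSum-prefix f (suc L) t = trans (cong (toℕ (f 0 t) +_) (coordSum-prefix (f ∘ suc) L t)) (sym (sumTo-suc L (λ i → toℕ (f i t))))

  AllIn-prefix : ∀ {r} {k : Fin r → ℕ} (S : ℕ → (t : Fin r) → Subset (k t)) (f : ℕ → G r k) L →
    (∀ i → i < L → InBox (S (suc i)) (f i)) → AllIn S (prefix f L)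
  AllIn-prefix S f zero f∈ = tt
  AllIn-prefix S f (suc L) f∈ = f∈ 0 (s≤s z≤n) , AllIn-prefix (S ∘ suc) (f ∘ suc) L (λ i i<L → f∈ (suc i) (s≤s i<L))

module Covering where

  open import Defs using (gcdDiffs; elems; ModEq)
  open Counting
  open import Data.Nat using (ℕ; zero; suc; _+_; _*_; _∸_; _≤_; _<_; _≟_; _%_; ∣_-_∣; s≤s)
  open import Data.Nat.Properties
  open import Data.Nat.DivMod using (m%n<n; m%n%n≡m%n; %-distribˡ-+; [m+n]%n≡m%n; [m+kn]%n≡m%n; m<n⇒m%n≡m)
  open import Data.Nat.GCD using (gcd; gcd-GCD; module Bézout)
  open import Data.Nat.Tactic.RingSolver using (solve-∀)
  open import Data.Fin using (Fin; zero; suc; toℕ; fromℕ<) renaming (_≟_ to _≟ᶠ_)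
  open import Data.Fin.Properties using (toℕ<n; toℕ-fromℕ<; toℕ-injective; any?; all?; ¬∀⟶∃¬)
  open import Data.Fin.Subset using (Subset; _∈_)
  open import Data.Fin.Subset.Properties using (_∈?_)
  open import Data.List using ([]; _∷_; map; allFin; foldr)
  open import Data.List.Properties using (filter-none; length-filter)
  open import Data.List.Membership.Propositional using () renaming (_∈_ to _∈ₗ_)
  open import Data.List.Membership.Propositional.Properties using (∈-allFin; ∈-map⁻; ∈-filter⁻)
  open import Data.List.Relation.Unary.All as All using (All; []; _∷_)
  open import Data.List.Relation.Unary.All.Properties using (concat⁺; map⁺)
  open import Data.List.Relation.Unary.Any.Properties using (tabulate⁺)
  open import Data.Product using (Σ; ∃; _×_; _,_; proj₁; proj₂)
  open import Data.Sum using (_⊎_; inj₁; inj₂)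
  open import Function using (id; _∘_)
  open import Relation.Nullary using (yes; no; contradiction)
  open import Relation.Nullary.Decidable using (_×-dec_; _→-dec_)
  open import Relation.Unary using (Decidable)
  open import Relation.Binary.Bundles using (Setoid)
  open import Relation.Binary.Structures using (IsEquivalence)
  import Relation.Binary.Reasoning.Setoid as SetoidReasoning
  open import Relation.Binary.PropositionalEquality

  _[_]≔_ : {A : Set} → (ℕ → A) → ℕ → A → ℕ → A
  (f [ j ]≔ a) i with i ≟ j
  ... | yes _ = a
  ... | no  _ = f i

  []≔-at : {A : Set} (f : ℕ → A) (j : ℕ) (a : A) → (f [ j ]≔ a) j ≡ a
  []≔-at f j a with j ≟ j
  ... | yes _ = refl
  ... | no j≢j = contradiction refl j≢j

  []≔-elsewhere : {A : Set} (f : ℕ → A) {i j : ℕ} (a : A) → i ≢ j → (f [ j ]≔ a) i ≡ f i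
  []≔-elsewhere f {i} {j} a i≢j with i ≟ j
  ... | yes i≡j = contradiction i≡j i≢j
  ... | no  _   = refl

  sumTo-[]≔ : {A : Set} (j : ℕ) (f : A → ℕ) (c : ℕ → A) (a : A) → sumTo (suc j) (f ∘ (c [ j ]≔ a)) ≡ sumTo j (f ∘ c) + f a
  sumTo-[]≔ j f c a = cong₂ _+_ (sumTo-cong j (λ i i<j → cong f ([]≔-elsewhere c a (<⇒≢ i<j)))) (cong f ([]≔-at c j a))

  gcdDiffs≡1⇒nonempty : ∀ {n} (B : Subset n) → gcdDiffs B ≡ 1 → ∃ (_∈ B)
  gcdDiffs≡1⇒nonempty B gcd≡1 with any? (_∈? B)
  ... | yes c∈B = c∈B
  ... | no ∄c∈B = contradiction (trans (sym gcd≡1) gcdDiffs≡0) λ ()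
    where
    elems≡[] : elems B ≡ []
    elems≡[] = cong (map toℕ) (filter-none (_∈? B) (All.universal (λ c c∈B → ∄c∈B (c , c∈B)) (allFin _)))
    gcdDiffs≡0 : gcdDiffs B ≡ 0
    gcdDiffs≡0 = cong (λ l → foldr gcd 0 (Data.List.concatMap (λ a → map (λ b → ∣ a - b ∣) l) l)) elems≡[]

  module Residues (n′ : ℕ) where

    N : ℕ
    N = suc n′

    infix 4 _≡ₘ_
    record _≡ₘ_ (a b : ℕ) : Set where
      constructor mk
      field %-≡ : a % N ≡ b % N
    open _≡ₘ_ public

    ≡ₘ-isEquivalence : IsEquivalence _≡ₘ_
    ≡ₘ-isEquivalence = record
      { refl  = mk refl
      ; sym   = λ (mk p) → mk (sym p)
      ; trans = λ (mk p) (mk q) → mk (trans p q)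
      }

    ≡ₘ-setoid : Setoid _ _
    ≡ₘ-setoid = record { isEquivalence = ≡ₘ-isEquivalence }

    open IsEquivalence ≡ₘ-isEquivalence public using () renaming (refl to ≡ₘ-refl; sym to ≡ₘ-sym; trans to ≡ₘ-trans)
    module ≡ₘ-Reasoning = SetoidReasoning ≡ₘ-setoid

    ≡⇒≡ₘ : ∀ {a b} → a ≡ b → a ≡ₘ b
    ≡⇒≡ₘ refl = ≡ₘ-refl

    +-congʳ : ∀ {a b} c → a ≡ₘ b → a + c ≡ₘ b + c
    +-congʳ {a} {b} c (mk e) = mk (trans (%-distribˡ-+ a c N) (trans (cong (λ z → (z + c % N) % N) e) (sym (%-distribˡ-+ b c N))))

    +-congˡ : ∀ {a b} c → a ≡ₘ b → c + a ≡ₘ c + b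
    +-congˡ {a} {b} c e = ≡ₘ-trans (≡⇒≡ₘ (+-comm c a)) (≡ₘ-trans (+-congʳ c e) (≡⇒≡ₘ (+-comm b c)))

    %-≡ₘ : ∀ a → a % N ≡ₘ a
    %-≡ₘ a = mk (m%n%n≡m%n a N)

    +N-≡ₘ : ∀ a → a + N ≡ₘ a
    +N-≡ₘ a = mk ([m+n]%n≡m%n a N)

    +*N-≡ₘ : ∀ a q → a + q * N ≡ₘ a
    +*N-≡ₘ a q = mk ([m+kn]%n≡m%n a q N)

    ModEq⇒≡ₘ : ∀ {a} {y : Fin N} → ModEq N a y → a ≡ₘ toℕ y
    ModEq⇒≡ₘ {y = y} a↦y = mk (trans a↦y (sym (m<n⇒m%n≡m (toℕ<n y))))

    ≡ₘ⇒ModEq : ∀ {a} {y : Fin N} → a ≡ₘ toℕ y → ModEq N a y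
    ≡ₘ⇒ModEq {y = y} e = trans (%-≡ e) (m<n⇒m%n≡m (toℕ<n y))

    toℕ-≡ₘ-injective : {x y : Fin N} → toℕ x ≡ₘ toℕ y → x ≡ y
    toℕ-≡ₘ-injective {x} e = toℕ-injective (trans (sym (m<n⇒m%n≡m (toℕ<n x))) (≡ₘ⇒ModEq e))

    shift : ℕ → Fin N → Fin N
    shift p x = fromℕ< (m%n<n (toℕ x + p) N)

    toℕ-shift : ∀ p x → toℕ (shift p x) ≡ₘ toℕ x + p
    toℕ-shift p x = ≡ₘ-trans (≡⇒≡ₘ (toℕ-fromℕ< (m%n<n (toℕ x + p) N))) (%-≡ₘ (toℕ x + p))

    shift-≡ₘ : ∀ {p q} x → p ≡ₘ q → shift p x ≡ shift q x
    shift-≡ₘ {p} {q} x p≡q = toℕ-≡ₘ-injective (begin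
      toℕ (shift p x) ≈⟨ toℕ-shift p x ⟩
      toℕ x + p       ≈⟨ +-congˡ (toℕ x) p≡q ⟩
      toℕ x + q       ≈⟨ toℕ-shift q x ⟨
      toℕ (shift q x) ∎)
      where open ≡ₘ-Reasoning

    shift-0 : ∀ x → shift 0 x ≡ x
    shift-0 x = toℕ-≡ₘ-injective (≡ₘ-trans (toℕ-shift 0 x) (≡⇒≡ₘ (+-identityʳ (toℕ x))))

    shift-shift : ∀ p q x → shift q (shift p x) ≡ shift (p + q) x
    shift-shift p q x = toℕ-≡ₘ-injective (begin
      toℕ (shift q (shift p x)) ≈⟨ toℕ-shift q (shift p x) ⟩
      toℕ (shift p x) + q       ≈⟨ +-congʳ q (toℕ-shift p x) ⟩
      toℕ x + p + q             ≡⟨ +-assoc (toℕ x) p q ⟩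
      toℕ x + (p + q)           ≈⟨ toℕ-shift (p + q) x ⟨
      toℕ (shift (p + q) x)     ∎)
      where open ≡ₘ-Reasoning

    cancelˡ-ModEq : ∀ u w (z s : Fin N) → ModEq N (u + toℕ z) s → ModEq N (u + w) s → ModEq N w z
    cancelˡ-ModEq u w z s u+z↦s u+w↦s = ≡ₘ⇒ModEq (begin
      w                  ≈⟨ +*N-≡ₘ w u ⟨
      w + u * N          ≡⟨ rearrange u w n′ ⟩
      u + w + n′ * u     ≈⟨ +-congʳ (n′ * u) (mk (trans u+w↦s (sym u+z↦s))) ⟩
      u + toℕ z + n′ * u ≡⟨ rearrange u (toℕ z) n′ ⟨
      toℕ z + u * N      ≈⟨ +*N-≡ₘ (toℕ z) u ⟩
      toℕ z              ∎)
      where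
      open ≡ₘ-Reasoning
      rearrange : ∀ u w n′ → w + u * suc n′ ≡ u + w + n′ * u
      rearrange = solve-∀

    +-ModEq : ∀ u w (z s : Fin N) → ModEq N (u + toℕ z) s → ModEq N w z → ModEq N (u + w) s
    +-ModEq u w z s u+z↦s w↦z = trans (%-≡ (+-congˡ u (ModEq⇒≡ₘ w↦z))) u+z↦s

    complement : ∀ u (s : Fin N) → Σ (Fin N) λ z → ModEq N (u + toℕ z) s
    complement u s = z , ≡ₘ⇒ModEq (begin
      u + toℕ z              ≈⟨ +-congˡ u (toℕ-shift (toℕ s + n′ * u) zero) ⟩
      u + (toℕ s + n′ * u)   ≡⟨ rearrange u (toℕ s) n′ ⟩
      toℕ s + u * N          ≈⟨ +*N-≡ₘ (toℕ s) u ⟩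
      toℕ s                  ∎)
      where
      open ≡ₘ-Reasoning
      z : Fin N
      z = shift (toℕ s + n′ * u) zero
      rearrange : ∀ u s n′ → u + (s + n′ * u) ≡ s + u * suc n′
      rearrange = solve-∀

  module Sumset (n′ : ℕ) (A : ℕ → Subset (suc n′)) (gcd≡1 : ∀ i → gcdDiffs (A i) ≡ 1) where
    open Residues n′

    base : ℕ → Fin N
    base i = proj₁ (gcdDiffs≡1⇒nonempty (A i) (gcd≡1 i))

    base∈A : ∀ i → base i ∈ A i
    base∈A i = proj₂ (gcdDiffs≡1⇒nonempty (A i) (gcd≡1 i))

    -- c − base j, represented without truncated subtraction
    gap : ℕ → Fin N → ℕ
    gap j c = toℕ c + (N ∸ toℕ (base j))

    base+gap : ∀ j c → toℕ (base j) + gap j c ≡ₘ toℕ c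
    base+gap j c = begin
      toℕ (base j) + (toℕ c + (N ∸ toℕ (base j))) ≡⟨ x∙yz≈y∙xz (toℕ (base j)) (toℕ c) _ ⟩
      toℕ c + (toℕ (base j) + (N ∸ toℕ (base j))) ≡⟨ cong (toℕ c +_) (m+[n∸m]≡n (<⇒≤ (toℕ<n (base j)))) ⟩
      toℕ c + N                                   ≈⟨ +N-≡ₘ (toℕ c) ⟩
      toℕ c                                       ∎
      where
      open ≡ₘ-Reasoning
      open import Algebra.Properties.CommutativeSemigroup +-commutativeSemigroup using (x∙yz≈y∙xz)

    -- Reachable j is the sumset (A 0 − base 0) + ⋯ + (A (j − 1) − base (j − 1)) in ℤ_N.
    Reachable : ℕ → Fin N → Set
    Reachable zero x = x ≡ zero
    Reachable (suc j) x = Σ (Fin N) λ c → c ∈ A j × Σ (Fin N) λ y → Reachable j y × shift (gap j c) y ≡ x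

    reachable? : ∀ j → Decidable (Reachable j)
    reachable? zero x = x ≟ᶠ zero
    reachable? (suc j) x = any? λ c → (c ∈? A j) ×-dec any? λ y → reachable? j y ×-dec (shift (gap j c) y ≟ᶠ x)

    Reachable-suc : ∀ j {x} → Reachable j x → Reachable (suc j) x
    Reachable-suc j {x} x∈ = base j , base∈A j , x , x∈ , toℕ-≡ₘ-injective (begin
      toℕ (shift (gap j (base j)) x)  ≈⟨ toℕ-shift (gap j (base j)) x ⟩
      toℕ x + gap j (base j)          ≡⟨ cong (toℕ x +_) (m+[n∸m]≡n (<⇒≤ (toℕ<n (base j)))) ⟩
      toℕ x + N                       ≈⟨ +N-≡ₘ (toℕ x) ⟩
      toℕ x                           ∎)
      where open ≡ₘ-Reasoning

    Reachable-zero : ∀ j → Reachable j zero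
    Reachable-zero zero = refl
    Reachable-zero (suc j) = Reachable-suc j (Reachable-zero j)

    Reachable⇒sum : ∀ j {x} → Reachable j x → Σ (ℕ → Fin N) λ c → (∀ i → i < j → c i ∈ A i) ×
                      toℕ x + sumTo j (toℕ ∘ base) ≡ₘ sumTo j (toℕ ∘ c)
    Reachable⇒sum zero refl = base , (λ _ ()) , ≡ₘ-refl
    Reachable⇒sum (suc j) (c₀ , c₀∈ , y , y∈ , refl) with Reachable⇒sum j y∈
    ... | c , c∈ , y+Σbase≡Σc = c [ j ]≔ c₀ , c′∈ , (begin
      toℕ (shift (gap j c₀) y) + (Σbase + toℕ (base j)) ≈⟨ +-congʳ _ (toℕ-shift (gap j c₀) y) ⟩
      toℕ y + gap j c₀ + (Σbase + toℕ (base j))        ≡⟨ rearrange (toℕ y) (gap j c₀) Σbase (toℕ (base j)) ⟩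
      (toℕ y + Σbase) + (toℕ (base j) + gap j c₀)      ≈⟨ +-congˡ _ (base+gap j c₀) ⟩
      (toℕ y + Σbase) + toℕ c₀                         ≈⟨ +-congʳ _ y+Σbase≡Σc ⟩
      sumTo j (toℕ ∘ c) + toℕ c₀                       ≡⟨ sumTo-[]≔ j toℕ c c₀ ⟨
      sumTo (suc j) (toℕ ∘ (c [ j ]≔ c₀))              ∎)
      where
      open ≡ₘ-Reasoning
      Σbase : ℕ
      Σbase = sumTo j (toℕ ∘ base)
      rearrange : ∀ y g s b → y + g + (s + b) ≡ (y + s) + (b + g)
      rearrange = solve-∀
      c′∈ : ∀ i → i < suc j → (c [ j ]≔ c₀) i ∈ A i
      c′∈ i i<1+j with i ≟ j
      ... | yes refl = c₀∈
      ... | no i≢j  = c∈ i (≤∧≢⇒< (≤-pred i<1+j) i≢j)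

    ShiftClosed : ℕ → ℕ → Set
    ShiftClosed j p = ∀ {x} → Reachable j x → Reachable j (shift p x)

    closed-0 : ∀ j → ShiftClosed j 0
    closed-0 j {x} = subst (Reachable j) (sym (shift-0 x))

    closed-+ : ∀ j {p q} → ShiftClosed j p → ShiftClosed j q → ShiftClosed j (p + q)
    closed-+ j {p} {q} p-closed q-closed {x} = subst (Reachable j) (shift-shift p q x) ∘ q-closed ∘ p-closed

    closed-≡ₘ : ∀ j {p q} → p ≡ₘ q → ShiftClosed j p → ShiftClosed j q
    closed-≡ₘ j p≡q p-closed {x} = subst (Reachable j) (shift-≡ₘ x p≡q) ∘ p-closed

    closed-* : ∀ j {p} → ShiftClosed j p → ∀ m → ShiftClosed j (m * p)
    closed-* j p-closed zero = closed-0 j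
    closed-* j p-closed (suc m) = closed-+ j p-closed (closed-* j p-closed m)

    -- Subtracting q means adding n′ * q, since q + n′ * q ≡ 0 (mod N).
    closed-∸ : ∀ j {p q} → ShiftClosed j (p + q) → ShiftClosed j q → ShiftClosed j p
    closed-∸ j {p} {q} p+q-closed q-closed = closed-≡ₘ j p+q+n′q≡p (closed-+ j p+q-closed (closed-* j q-closed n′))
      where
      p+q+n′q≡p : p + q + n′ * q ≡ₘ p
      p+q+n′q≡p = ≡ₘ-trans (≡⇒≡ₘ (trans (+-assoc p q (n′ * q)) (cong (p +_) (*-comm N q)))) (+*N-≡ₘ p q)

    closed-gcd : ∀ j {p q} → ShiftClosed j p → ShiftClosed j q → ShiftClosed j (gcd p q)
    closed-gcd j {p} {q} p-closed q-closed with Bézout.identity (gcd-GCD p q)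
    ... | Bézout.+- a b d+bq≡ap = closed-∸ j (subst (ShiftClosed j) (sym d+bq≡ap) (closed-* j p-closed a)) (closed-* j q-closed b)
    ... | Bézout.-+ a b d+ap≡bq = closed-∸ j (subst (ShiftClosed j) (sym d+ap≡bq) (closed-* j q-closed b)) (closed-* j p-closed a)

    closed-foldr-gcd : ∀ j ps → All (ShiftClosed j) ps → ShiftClosed j (foldr gcd 0 ps)
    closed-foldr-gcd j [] [] = closed-0 j
    closed-foldr-gcd j (p ∷ ps) (p-closed ∷ ps-closed) = closed-gcd j p-closed (closed-foldr-gcd j ps ps-closed)

    closed-∸-gap : ∀ j → (∀ {c} → c ∈ A j → ShiftClosed j (gap j c)) →
      ∀ {c c′} → c ∈ A j → c′ ∈ A j → toℕ c′ ≤ toℕ c → ShiftClosed j (toℕ c ∸ toℕ c′)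
    closed-∸-gap j gaps-closed {c} {c′} c∈ c′∈ c′≤c = closed-∸ j (subst (ShiftClosed j) gap-split (gaps-closed c∈)) (gaps-closed c′∈)
      where
      gap-split : gap j c ≡ toℕ c ∸ toℕ c′ + gap j c′
      gap-split = trans (cong (_+ (N ∸ toℕ (base j))) (sym (m∸n+n≡m c′≤c))) (+-assoc (toℕ c ∸ toℕ c′) (toℕ c′) _)

    closed-∣-∣ : ∀ j → (∀ {c} → c ∈ A j → ShiftClosed j (gap j c)) →
      ∀ {c c′} → c ∈ A j → c′ ∈ A j → ShiftClosed j ∣ toℕ c - toℕ c′ ∣
    closed-∣-∣ j gaps-closed {c} {c′} c∈ c′∈ with ≤-total (toℕ c′) (toℕ c)
    ... | inj₁ c′≤c = subst (ShiftClosed j) (sym (m≤n⇒∣n-m∣≡n∸m c′≤c)) (closed-∸-gap j gaps-closed c∈ c′∈ c′≤c)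
    ... | inj₂ c≤c′ = subst (ShiftClosed j) (trans (sym (m≤n⇒∣n-m∣≡n∸m c≤c′)) (∣-∣-comm (toℕ c′) (toℕ c)))
                            (closed-∸-gap j gaps-closed c′∈ c∈ c≤c′)

    elems⁻ : ∀ (B : Subset N) {a} → a ∈ₗ elems B → Σ (Fin N) λ c → c ∈ B × a ≡ toℕ c
    elems⁻ B a∈ with ∈-map⁻ toℕ a∈
    ... | c , c∈ , refl = c , proj₂ (∈-filter⁻ (_∈? B) {xs = allFin N} c∈) , refl

    closed-1 : ∀ j → (∀ {c} → c ∈ A j → ShiftClosed j (gap j c)) → ShiftClosed j 1
    closed-1 j gaps-closed = subst (ShiftClosed j) (gcd≡1 j)
      (closed-foldr-gcd j _ (concat⁺ (map⁺ (All.tabulate λ a∈ → map⁺ (All.tabulate λ a′∈ → closed-difference a∈ a′∈)))))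
      where
      closed-difference : ∀ {a a′} → a ∈ₗ elems (A j) → a′ ∈ₗ elems (A j) → ShiftClosed j ∣ a - a′ ∣
      closed-difference a∈ a′∈ with elems⁻ (A j) a∈ | elems⁻ (A j) a′∈
      ... | c , c∈ , refl | c′ , c′∈ , refl = closed-∣-∣ j gaps-closed c∈ c′∈

    Full : ℕ → Set
    Full j = ∀ x → Reachable j x

    closed-1⇒Full : ∀ j → ShiftClosed j 1 → Full j
    closed-1⇒Full j 1-closed x = subst (Reachable j) shift-x-zero (closed-* j 1-closed (toℕ x) (Reachable-zero j))
      where
      shift-x-zero : shift (toℕ x * 1) zero ≡ x
      shift-x-zero = toℕ-≡ₘ-injective (≡ₘ-trans (toℕ-shift (toℕ x * 1) zero) (≡⇒≡ₘ (*-identityʳ (toℕ x))))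

    -- If the sumset stops growing at step j, it is invariant under every gap c − base j.
    stagnant⇒Full : ∀ j → (∀ {x} → Reachable (suc j) x → Reachable j x) → Full j
    stagnant⇒Full j stagnant = closed-1⇒Full j (closed-1 j λ {c} c∈ {x} x∈ → stagnant (c , c∈ , x , x∈ , refl))

    #Reachable : ℕ → ℕ
    #Reachable j = #filter (reachable? j) (allFin N)

    Full⊎#Reachable> : ∀ j → Full j ⊎ j < #Reachable j
    Full⊎#Reachable> zero = inj₂ (#filter-pos (reachable? zero) (tabulate⁺ {f = id} zero refl))
    Full⊎#Reachable> (suc j) with Full⊎#Reachable> j
    ... | inj₁ full = inj₁ (λ x → Reachable-suc j (full x))
    ... | inj₂ j<#R with all? (λ x → reachable? (suc j) x →-dec reachable? j x)
    ...   | yes stagnant = inj₁ (λ x → Reachable-suc j (stagnant⇒Full j (stagnant _) x))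
    ...   | no ¬stagnant with ¬∀⟶∃¬ N _ (λ x → reachable? (suc j) x →-dec reachable? j x) ¬stagnant
    ...     | x , new with reachable? (suc j) x
    ...       | yes x∈ = inj₂ (<-≤-trans (s≤s j<#R)
                  (#filter-strictMono (reachable? j) (reachable? (suc j)) (Reachable-suc j) (∈-allFin x) x∈ (new ∘ λ x∈ _ → x∈)))
    ...       | no  x∉ = contradiction (λ x∈ → contradiction x∈ x∉) new

    Full-N : Full N
    Full-N with Full⊎#Reachable> N
    ... | inj₁ full = full
    ... | inj₂ N<#R = contradiction (<-≤-trans N<#R #Reachable≤N) (<-irrefl refl)
      where
      #Reachable≤N : #Reachable N ≤ N
      #Reachable≤N = subst (#Reachable N ≤_) (length-allFin N) (length-filter (reachable? N) (allFin N))

    Full-+ : ∀ d {j} → Full j → Full (d + j)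
    Full-+ zero full = full
    Full-+ (suc d) full x = Reachable-suc _ (Full-+ d full x)

    cover : ∀ L → N ≤ L → (y : Fin N) → Σ (ℕ → Fin N) λ c → (∀ i → i < L → c i ∈ A i) × ModEq N (sumTo L (toℕ ∘ c)) y
    cover L N≤L y =
      let c , c∈ , x+Σbase≡Σc = Reachable⇒sum L (Full-L x) in
      c , c∈ , ≡ₘ⇒ModEq (begin
        sumTo L (toℕ ∘ c)                ≈⟨ x+Σbase≡Σc ⟨
        toℕ x + Σbase                    ≈⟨ +-congʳ Σbase (toℕ-shift (toℕ y + n′ * Σbase) zero) ⟩
        toℕ y + n′ * Σbase + Σbase       ≡⟨ rearrange (toℕ y) n′ Σbase ⟩
        toℕ y + Σbase * N                ≈⟨ +*N-≡ₘ (toℕ y) Σbase ⟩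
        toℕ y                            ∎)
      where
      open ≡ₘ-Reasoning
      Σbase : ℕ
      Σbase = sumTo L (toℕ ∘ base)
      x : Fin N
      x = shift (toℕ y + n′ * Σbase) zero
      Full-L : Full L
      Full-L = subst Full (m∸n+n≡m N≤L) (Full-+ (L ∸ N) Full-N)
      rearrange : ∀ y n′ s → y + n′ * s + s ≡ y + s * suc n′
      rearrange = solve-∀

  cover : (n : ℕ) (A : ℕ → Subset n) → (∀ i → gcdDiffs (A i) ≡ 1) → ∀ L → n ≤ L → (y : Fin n) →
    Σ (ℕ → Fin n) λ c → (∀ i → i < L → c i ∈ A i) × ModEq n (sumTo L (toℕ ∘ c)) y
  cover (suc n′) A gcd≡1 = Sumset.cover n′ A gcd≡1

  cancelˡ-ModEq : ∀ n u w (z s : Fin n) → ModEq n (u + toℕ z) s → ModEq n (u + w) s → ModEq n w z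
  cancelˡ-ModEq (suc n′) = Residues.cancelˡ-ModEq n′

  +-ModEq : ∀ n u w (z s : Fin n) → ModEq n (u + toℕ z) s → ModEq n w z → ModEq n (u + w) s
  +-ModEq (suc n′) = Residues.+-ModEq n′

  complement : ∀ n u (s : Fin n) → Σ (Fin n) λ z → ModEq n (u + toℕ z) s
  complement (suc n′) = Residues.complement n′

module Bernoulli where

  open import Data.Nat using (ℕ; zero; suc; _+_; _*_; _∸_; _≤_; _^_; z≤n)
  open import Data.Nat.Properties
  open import Data.Nat.Tactic.RingSolver using (solve-∀)
  open import Data.Sum using (inj₁; inj₂)
  open import Relation.Binary.PropositionalEquality

  [1+P]*[P∸j]≤P*[1+P∸j] : ∀ P j → suc P * (P ∸ j) ≤ P * (suc P ∸ j)
  [1+P]*[P∸j]≤P*[1+P∸j] P j with ≤-total j P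
  ... | inj₁ j≤P = begin
    suc P * (P ∸ j)      ≤⟨ +-monoˡ-≤ (P * (P ∸ j)) (m∸n≤m P j) ⟩
    P + P * (P ∸ j)      ≡⟨ *-suc P (P ∸ j) ⟨
    P * suc (P ∸ j)      ≡⟨ cong (P *_) (+-∸-assoc 1 j≤P) ⟨
    P * (suc P ∸ j)      ∎
    where open ≤-Reasoning
  ... | inj₂ P≤j = begin
    suc P * (P ∸ j)      ≡⟨ cong (suc P *_) (m≤n⇒m∸n≡0 P≤j) ⟩
    suc P * 0            ≡⟨ *-zeroʳ (suc P) ⟩
    0                    ≤⟨ z≤n ⟩
    P * (suc P ∸ j)      ∎
    where open ≤-Reasoning

  [1+P]^j*[1+P∸j]≤P^j*[1+P] : ∀ P j → suc P ^ j * (suc P ∸ j) ≤ P ^ j * suc P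
  [1+P]^j*[1+P∸j]≤P^j*[1+P] P zero = ≤-refl
  [1+P]^j*[1+P∸j]≤P^j*[1+P] P (suc j) = begin
    suc P ^ suc j * (P ∸ j)        ≡⟨ rearrange₁ (suc P) (suc P ^ j) (P ∸ j) ⟩
    suc P ^ j * (suc P * (P ∸ j))  ≤⟨ *-monoʳ-≤ (suc P ^ j) ([1+P]*[P∸j]≤P*[1+P∸j] P j) ⟩
    suc P ^ j * (P * (suc P ∸ j))  ≡⟨ rearrange₂ (suc P ^ j) P (suc P ∸ j) ⟩
    P * (suc P ^ j * (suc P ∸ j))  ≤⟨ *-monoʳ-≤ P ([1+P]^j*[1+P∸j]≤P^j*[1+P] P j) ⟩
    P * (P ^ j * suc P)            ≡⟨ *-assoc P (P ^ j) (suc P) ⟨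
    P ^ suc j * suc P              ∎
    where
    open ≤-Reasoning
    rearrange₁ : ∀ b bʲ d → b * bʲ * d ≡ bʲ * (b * d)
    rearrange₁ = solve-∀
    rearrange₂ : ∀ bʲ p d → bʲ * (p * d) ≡ p * (bʲ * d)
    rearrange₂ = solve-∀

  [1+P]^L*E≤P^L*[1+E] : ∀ E L → suc (suc E * L) ^ L * E ≤ (suc E * L) ^ L * suc E
  [1+P]^L*E≤P^L*[1+E] E L = *-cancelʳ-≤ (B ^ L * E) (P ^ L * suc E) B (begin
    B ^ L * E * B              ≡⟨ *-assoc (B ^ L) E B ⟩
    B ^ L * (E * B)            ≤⟨ *-monoʳ-≤ (B ^ L) E*B≤[B∸L]*[1+E] ⟩
    B ^ L * ((B ∸ L) * suc E)  ≡⟨ *-assoc (B ^ L) (B ∸ L) (suc E) ⟨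
    B ^ L * (B ∸ L) * suc E    ≤⟨ *-monoˡ-≤ (suc E) ([1+P]^j*[1+P∸j]≤P^j*[1+P] P L) ⟩
    P ^ L * B * suc E          ≡⟨ rearrange (P ^ L) B (suc E) ⟩
    P ^ L * suc E * B          ∎)
    where
    open ≤-Reasoning
    P B : ℕ
    P = suc E * L
    B = suc P
    rearrange : ∀ a b c → a * b * c ≡ a * c * b
    rearrange = solve-∀
    B∸L≡1+EL : B ∸ L ≡ suc (E * L)
    B∸L≡1+EL = trans (cong (_∸ L) (sym (+-suc L (E * L)))) (m+n∸m≡n L (suc (E * L)))
    E*B≤[B∸L]*[1+E] : E * B ≤ (B ∸ L) * suc E
    E*B≤[B∸L]*[1+E] = begin
      E * B                    ≡⟨ lhs E L ⟩
      E * (L + E * L) + E      ≤⟨ n≤1+n _ ⟩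
      suc (E * (L + E * L) + E) ≡⟨ rhs E L ⟨
      suc (E * L) * suc E      ≡⟨ cong (_* suc E) B∸L≡1+EL ⟨
      (B ∸ L) * suc E          ∎
      where
      lhs : ∀ e l → e * suc (suc e * l) ≡ e * (l + e * l) + e
      lhs = solve-∀
      rhs : ∀ e l → suc (e * l) * suc e ≡ suc (e * (l + e * l) + e)
      rhs = solve-∀

  -- Since n/(1 + n) ≤ E/(1 + E) for n ≤ E, the same bound holds with E replaced by n.
  n*[1+P]^L≤P^L*[1+n] : ∀ E L n → n ≤ E → n * suc (suc E * L) ^ L ≤ (suc E * L) ^ L * suc n
  n*[1+P]^L≤P^L*[1+n] zero L zero _ = z≤n
  n*[1+P]^L≤P^L*[1+n] E@(suc _) L n n≤E = *-cancelʳ-≤ (n * B ^ L) (P ^ L * suc n) E (begin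
    n * B ^ L * E        ≡⟨ *-assoc n (B ^ L) E ⟩
    n * (B ^ L * E)      ≤⟨ *-monoʳ-≤ n ([1+P]^L*E≤P^L*[1+E] E L) ⟩
    n * (P ^ L * suc E)  ≡⟨ x∙yz≈y∙xz n (P ^ L) (suc E) ⟩
    P ^ L * (n * suc E)  ≤⟨ *-monoʳ-≤ (P ^ L) n*[1+E]≤[1+n]*E ⟩
    P ^ L * (suc n * E)  ≡⟨ *-assoc (P ^ L) (suc n) E ⟨
    P ^ L * suc n * E    ∎)
    where
    open ≤-Reasoning
    open import Algebra.Properties.CommutativeSemigroup *-commutativeSemigroup using (x∙yz≈y∙xz)
    P B : ℕ
    P = suc E * L
    B = suc P
    n*[1+E]≤[1+n]*E : n * suc E ≤ suc n * E
    n*[1+E]≤[1+n]*E = subst (_≤ suc n * E) (sym (*-suc n E)) (+-monoˡ-≤ (n * E) n≤E)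

module RationalBounds where

  open import Defs using (_^ℚ_)
  open import Data.Nat as ℕ using (ℕ; zero; suc)
  import Data.Nat.Properties as ℕ
  open import Data.Integer as ℤ using (+_; +≤+; +<+)
  import Data.Integer.Properties as ℤ
  open import Data.Integer.Tactic.RingSolver using (solve-∀)
  open import Data.Rational using (ℚ; _+_; _*_; _-_; -_; ∣_∣; _/_; _≤_; _<_; 0ℚ; 1ℚ; toℚᵘ; Positive; positive)
  open import Data.Rational.Properties
    using (toℚᵘ-injective; toℚᵘ-fromℚᵘ; toℚᵘ-homo-+; toℚᵘ-homo-*; toℚᵘ-cancel-≤; toℚᵘ-cancel-<;
           ∣p∣≡p∨∣p∣≡-p; +-monoˡ-≤; ≤-trans; *-cancelʳ-≤-pos; *-identityˡ)
  open import Data.Rational.Unnormalised as ℚᵘ using (mkℚᵘ; *≡*; *≤*; *<*)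
  import Data.Rational.Unnormalised.Properties as ℚᵘ
  open import Data.Rational.Solver using (module +-*-Solver)
  open import Data.Sum using (inj₁; inj₂)
  open import Relation.Binary.PropositionalEquality
  open +-*-Solver

  fromℕ : ℕ → ℚ
  fromℕ n = + n / 1

  toℚᵘ-fromℕ : ∀ n → toℚᵘ (fromℕ n) ℚᵘ.≃ mkℚᵘ (+ n) 0
  toℚᵘ-fromℕ n = toℚᵘ-fromℚᵘ (mkℚᵘ (+ n) 0)

  fromℕ-+ : ∀ a b → fromℕ (a ℕ.+ b) ≡ fromℕ a + fromℕ b
  fromℕ-+ a b = toℚᵘ-injective (ℚᵘ.≃-trans (toℚᵘ-fromℕ (a ℕ.+ b)) (ℚᵘ.≃-trans (*≡* unnormalised-+)
    (ℚᵘ.≃-sym (ℚᵘ.≃-trans (toℚᵘ-homo-+ (fromℕ a) (fromℕ b)) (ℚᵘ.+-cong (toℚᵘ-fromℕ a) (toℚᵘ-fromℕ b))))))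
    where
    distrib : ∀ x y → (x ℤ.+ y) ℤ.* ℤ.1ℤ ≡ (x ℤ.* ℤ.1ℤ ℤ.+ y ℤ.* ℤ.1ℤ) ℤ.* ℤ.1ℤ
    distrib = solve-∀
    unnormalised-+ : + (a ℕ.+ b) ℤ.* + 1 ≡ (+ a ℤ.* + 1 ℤ.+ + b ℤ.* + 1) ℤ.* + 1
    unnormalised-+ = trans (cong (ℤ._* + 1) (ℤ.pos-+ a b)) (distrib (+ a) (+ b))

  fromℕ-* : ∀ a b → fromℕ (a ℕ.* b) ≡ fromℕ a * fromℕ b
  fromℕ-* a b = toℚᵘ-injective (ℚᵘ.≃-trans (toℚᵘ-fromℕ (a ℕ.* b)) (ℚᵘ.≃-trans (*≡* (cong (ℤ._* + 1) (ℤ.pos-* a b)))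
    (ℚᵘ.≃-sym (ℚᵘ.≃-trans (toℚᵘ-homo-* (fromℕ a) (fromℕ b)) (ℚᵘ.*-cong (toℚᵘ-fromℕ a) (toℚᵘ-fromℕ b))))))

  fromℕ-mono-≤ : ∀ {a b} → a ℕ.≤ b → fromℕ a ≤ fromℕ b
  fromℕ-mono-≤ {a} {b} a≤b = toℚᵘ-cancel-≤ (ℚᵘ.≤-respˡ-≃ (ℚᵘ.≃-sym (toℚᵘ-fromℕ a)) (ℚᵘ.≤-respʳ-≃ (ℚᵘ.≃-sym (toℚᵘ-fromℕ b))
    (*≤* (subst₂ ℤ._≤_ (sym (ℤ.*-identityʳ (+ a))) (sym (ℤ.*-identityʳ (+ b))) (+≤+ a≤b)))))

  fromℕ-pos : ∀ {n} → 0 ℕ.< n → 0ℚ < fromℕ n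
  fromℕ-pos {n} 0<n = toℚᵘ-cancel-< (ℚᵘ.<-respʳ-≃ (ℚᵘ.≃-sym (toℚᵘ-fromℕ n))
    (*<* (subst (+ 0 ℤ.<_) (sym (ℤ.*-identityʳ (+ n))) (+<+ 0<n))))

  ∣p-q∣≤r : ∀ p q r → p ≤ q + r → q ≤ p + r → ∣ p - q ∣ ≤ r
  ∣p-q∣≤r p q r p≤q+r q≤p+r with ∣p∣≡p∨∣p∣≡-p (p - q)
  ... | inj₁ ∣p-q∣≡p-q = subst (_≤ r) (sym ∣p-q∣≡p-q) (subst (p - q ≤_) (cancel q r) (+-monoˡ-≤ (- q) p≤q+r))
    where
    cancel : ∀ q r → (q + r) + - q ≡ r
    cancel = solve 2 (λ q r → (q :+ r) :+ (:- q) := r) refl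
  ... | inj₂ ∣p-q∣≡q-p = subst (_≤ r) (sym ∣p-q∣≡q-p) (subst₂ _≤_ (negate p q) (cancel p r) (+-monoˡ-≤ (- p) q≤p+r))
    where
    negate : ∀ p q → q + - p ≡ - (p - q)
    negate = solve 2 (λ p q → q :+ (:- p) := :- (p :+ (:- q))) refl
    cancel : ∀ p r → (p + r) + - p ≡ r
    cancel = solve 2 (λ p r → (p :+ r) :+ (:- p) := r) refl

  module Ratio (P : ℕ) where

    θ : ℚ
    θ = + P / suc P

    toℚᵘ-θ : toℚᵘ θ ℚᵘ.≃ mkℚᵘ (+ P) P
    toℚᵘ-θ = toℚᵘ-fromℚᵘ (mkℚᵘ (+ P) P)

    θ-pos : 0 ℕ.< P → 0ℚ < θ
    θ-pos 0<P = toℚᵘ-cancel-< (ℚᵘ.<-respʳ-≃ (ℚᵘ.≃-sym toℚᵘ-θ) (*<* (subst (+ 0 ℤ.<_) (sym (ℤ.*-identityʳ (+ P))) (+<+ 0<P))))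

    θ<1 : θ < 1ℚ
    θ<1 = toℚᵘ-cancel-< (ℚᵘ.<-respˡ-≃ (ℚᵘ.≃-sym toℚᵘ-θ)
      (*<* (subst₂ ℤ._<_ (sym (ℤ.*-identityʳ (+ P))) (sym (ℤ.*-identityˡ (+ suc P))) (+<+ (ℕ.n<1+n P)))))

    θ*[1+P]≡P : θ * fromℕ (suc P) ≡ fromℕ P
    θ*[1+P]≡P = toℚᵘ-injective (ℚᵘ.≃-trans (toℚᵘ-homo-* θ (fromℕ (suc P)))
      (ℚᵘ.≃-trans (ℚᵘ.*-cong toℚᵘ-θ (toℚᵘ-fromℕ (suc P))) (ℚᵘ.≃-trans (*≡* cross) (ℚᵘ.≃-sym (toℚᵘ-fromℕ P)))))
      where
      cross : (+ P ℤ.* + suc P) ℤ.* + 1 ≡ + P ℤ.* + suc (P ℕ.* 1)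
      cross = trans (ℤ.*-identityʳ _) (cong (λ z → + P ℤ.* + suc z) (sym (ℕ.*-identityʳ P)))

    θ^m*[1+P]^m≡P^m : ∀ m → (θ ^ℚ m) * fromℕ (suc P ℕ.^ m) ≡ fromℕ (P ℕ.^ m)
    θ^m*[1+P]^m≡P^m zero = *-identityˡ (fromℕ 1)
    θ^m*[1+P]^m≡P^m (suc m) = begin
      θ * (θ ^ℚ m) * fromℕ (suc P ℕ.* suc P ℕ.^ m)                   ≡⟨ cong (θ * (θ ^ℚ m) *_) (fromℕ-* (suc P) (suc P ℕ.^ m)) ⟩
      θ * (θ ^ℚ m) * (fromℕ (suc P) * fromℕ (suc P ℕ.^ m))           ≡⟨ interchange θ (θ ^ℚ m) (fromℕ (suc P)) (fromℕ (suc P ℕ.^ m)) ⟩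
      θ * fromℕ (suc P) * ((θ ^ℚ m) * fromℕ (suc P ℕ.^ m))           ≡⟨ cong₂ _*_ θ*[1+P]≡P (θ^m*[1+P]^m≡P^m m) ⟩
      fromℕ P * fromℕ (P ℕ.^ m)                                      ≡⟨ fromℕ-* P (P ℕ.^ m) ⟨
      fromℕ (P ℕ.^ suc m)                                            ∎
      where
      open ≡-Reasoning
      interchange : ∀ a b c d → a * b * (c * d) ≡ a * c * (b * d)
      interchange = solve 4 (λ a b c d → (a :* b) :* (c :* d) := (a :* c) :* (b :* d)) refl

    deviation-bound : ∀ X Y W C m → X ℕ.≤ Y ℕ.+ W → Y ℕ.≤ X ℕ.+ W → W ℕ.* suc P ℕ.^ m ℕ.≤ C ℕ.* P ℕ.^ m ℕ.* Y →
      ∣ fromℕ X - fromℕ Y ∣ ≤ fromℕ C * (θ ^ℚ m) * fromℕ Y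
    deviation-bound X Y W C m X≤Y+W Y≤X+W W-bound = ≤-trans
      (∣p-q∣≤r (fromℕ X) (fromℕ Y) (fromℕ W) (subst (fromℕ X ≤_) (fromℕ-+ Y W) (fromℕ-mono-≤ X≤Y+W))
                                            (subst (fromℕ Y ≤_) (fromℕ-+ X W) (fromℕ-mono-≤ Y≤X+W)))
      (*-cancelʳ-≤-pos (fromℕ Bᵐ) (subst₂ _≤_ (fromℕ-* W Bᵐ) clear-denominator (fromℕ-mono-≤ W-bound)))
      where
      Bᵐ : ℕ
      Bᵐ = suc P ℕ.^ m
      instance
        Bᵐ-pos : Positive (fromℕ Bᵐ)
        Bᵐ-pos = positive (fromℕ-pos (ℕ.m^n>0 (suc P) m))
      clear-denominator : fromℕ (C ℕ.* P ℕ.^ m ℕ.* Y) ≡ fromℕ C * (θ ^ℚ m) * fromℕ Y * fromℕ Bᵐ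
      clear-denominator = begin
        fromℕ (C ℕ.* P ℕ.^ m ℕ.* Y)                   ≡⟨ trans (fromℕ-* (C ℕ.* P ℕ.^ m) Y) (cong (_* fromℕ Y) (fromℕ-* C (P ℕ.^ m))) ⟩
        fromℕ C * fromℕ (P ℕ.^ m) * fromℕ Y           ≡⟨ cong (λ z → fromℕ C * z * fromℕ Y) (θ^m*[1+P]^m≡P^m m) ⟨
        fromℕ C * ((θ ^ℚ m) * fromℕ Bᵐ) * fromℕ Y     ≡⟨ rearrange (fromℕ C) (θ ^ℚ m) (fromℕ Bᵐ) (fromℕ Y) ⟩
        fromℕ C * (θ ^ℚ m) * fromℕ Y * fromℕ Bᵐ       ∎
        where
        open ≡-Reasoning
        rearrange : ∀ c t b y → c * (t * b) * y ≡ c * t * y * b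
        rearrange = solve 4 (λ c t b y → c :* (t :* b) :* y := c :* t :* y :* b) refl

open import Defs
open import Data.Nat as ℕ using (ℕ; _≥_)
open import Data.Fin using (Fin)

module Equidistribution (r : ℕ) (k : Fin r → ℕ) (k≥2 : ∀ t → k t ≥ 2) where

  open Counting
  open Enumeration
  open Covering using (cover; cancelˡ-ModEq; +-ModEq; complement)
  open Bernoulli using (n*[1+P]^L≤P^L*[1+n])
  open import Data.Nat using (ℕ; suc; _+_; _*_; _∸_; _≤_; _<_; _≥_; _^_; z≤n; s≤s; _<?_)
  open import Data.Nat.Properties
  open import Data.Nat.Induction using (<-rec)
  open import Data.Nat.Tactic.RingSolver using (solve-∀)
  open import Data.Fin using (Fin; toℕ; fromℕ<)
  open import Data.Fin.Properties using (toℕ-fromℕ<)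
  open import Data.Fin.Subset using (Subset; _∈_)
  open import Data.List using (length)
  open import Function using (_∘_)
  open import Data.List.Properties using (length-filter)
  open import Data.List.Relation.Unary.Any using (Any)
  import Data.List.Relation.Unary.Any as Any
  open import Data.Vec using (Vec; _++_)
  open import Data.Product using (Σ; _×_; _,_; proj₁; proj₂)
  open import Relation.Nullary using (¬_; yes; no)
  open import Relation.Nullary.Decidable using (_×-dec_)
  open import Relation.Binary.PropositionalEquality

  Boxes : Set
  Boxes = ℕ → (t : Fin r) → Subset (k t)

  GcdCondition : Boxes → Set
  GcdCondition S = ∀ (t : Fin r) (j : ℕ) → j ≥ 1 → gcdDiffs (S j t) ≡ 1

  k≥1 : ∀ t → 1 ≤ k t
  k≥1 t = ≤-trans (s≤s z≤n) (k≥2 t)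

  |G| : ℕ
  |G| = length (allG r k)

  |G|≡prodFin : |G| ≡ prodFin r k
  |G|≡prodFin = length-allG r k

  -- The block length: long enough to reach every residue in every coordinate.
  L : ℕ
  L = |G|

  L≥1 : 1 ≤ L
  L≥1 = subst (1 ≤_) (sym |G|≡prodFin) (prodFin-pos r k k≥1)

  k≤L : ∀ t → k t ≤ L
  k≤L t = subst (k t ≤_) (sym |G|≡prodFin) (k≤prodFin r k k≥1 t)

  E : ℕ
  E = |G| ^ L ∸ 1

  1+E≡|G|^L : suc E ≡ |G| ^ L
  1+E≡|G|^L = trans (+-comm 1 E) (m∸n+n≡m (subst (_≤ |G| ^ L) (^-zeroˡ L) (^-monoˡ-≤ L L≥1)))

  P : ℕ
  P = suc E * L

  P≥1 : 1 ≤ P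
  P≥1 = *-mono-≤ {1} {suc E} (s≤s z≤n) L≥1

  zeroG : G r k
  zeroG t = fromℕ< (k≥1 t)

  every-sum-attained : ∀ S → GcdCondition S → ∀ y → Any (λ u → AllIn S u × SumsTo u y) (allTuples r k L)
  every-sum-attained S gcdS y =
    Any.map (λ u≋v → AllIn-≋ S u≋v u∈ , SumsTo-≋ u≋v u↦y) (allTuples-complete r k L u)
    where
    choice : ∀ t → Σ (ℕ → Fin (k t)) λ c → (∀ i → i < L → c i ∈ S (suc i) t) × ModEq (k t) (sumTo L (toℕ ∘ c)) (y t)
    choice t = cover (k t) (λ i → S (suc i) t) (λ i → gcdS t (suc i) (s≤s z≤n)) L (k≤L t) (y t)
    u : Vec (G r k) L
    u = prefix (λ i t → proj₁ (choice t) i) L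
    u∈ : AllIn S u
    u∈ = AllIn-prefix S _ L (λ i i<L t → proj₁ (proj₂ (choice t)) i i<L)
    u↦y : SumsTo u y
    u↦y t = subst (λ z → ModEq (k t) z (y t)) (sym (coordSum-prefix _ L t)) (proj₂ (proj₂ (choice t)))

  record Spread (S : Boxes) (m : ℕ) : Set where
    field
      low width : ℕ
      low≤count : ∀ y → low ≤ count r k S m y
      count≤low+width : ∀ y → count r k S m y ≤ low + width
      width-bound : width * suc P ^ m ≤ suc P ^ L * P ^ m * #AllIn r k S m

  spread-short : ∀ S m → m < L → Spread S m
  spread-short S m m<L = record
    { low = 0
    ; width = #AllIn r k S m
    ; low≤count = λ _ → z≤n
    ; count≤low+width = λ y → #filter-mono (λ xs → allIn? S xs ×-dec sumsTo? xs y) (allIn? S) proj₁ (allTuples r k m)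
    ; width-bound = begin
        #AllIn r k S m * suc P ^ m           ≤⟨ *-monoʳ-≤ (#AllIn r k S m) (^-monoʳ-≤ (suc P) (<⇒≤ m<L)) ⟩
        #AllIn r k S m * suc P ^ L           ≡⟨ *-comm (#AllIn r k S m) (suc P ^ L) ⟩
        suc P ^ L * #AllIn r k S m           ≡⟨ cong (_* #AllIn r k S m) (*-identityʳ (suc P ^ L)) ⟨
        suc P ^ L * 1 * #AllIn r k S m       ≤⟨ *-monoˡ-≤ (#AllIn r k S m) (*-monoʳ-≤ (suc P ^ L) P^m≥1) ⟩
        suc P ^ L * P ^ m * #AllIn r k S m   ∎
    }
    where
    open ≤-Reasoning
    P^m≥1 : 1 ≤ P ^ m
    P^m≥1 = subst (_≤ P ^ m) (^-zeroˡ m) (^-monoˡ-≤ m P≥1)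

  -- Every tuple of the first L boxes extends in c(s − x₁ − ⋯ − x_L; S_{L+1}, …) ways, and one of them,
  -- whose sum is s itself, extends in exactly c(0; S_{L+1}, …) ways whatever s is.
  module Step (S : Boxes) (gcdS : GcdCondition S) {m : ℕ} (spread′ : Spread (λ j → S (L + j)) m) where
    open Spread spread′
      renaming (low to a′; width to D′; low≤count to a′≤count; count≤low+width to count≤a′+D′; width-bound to D′-bound)

    S′ : Boxes
    S′ j = S (L + j)

    Z : ℕ
    Z = count r k S′ m zeroG

    #first : ℕ
    #first = #AllIn r k S L

    #first′ : ℕ
    #first′ = #first ∸ 1

    1+#first′≡#first : suc #first′ ≡ #first
    1+#first′≡#first = trans (+-comm 1 #first′) (m∸n+n≡m (#filter-pos (allIn? S) (Any.map proj₁ (every-sum-attained S gcdS zeroG))))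

    completions : G r k → Vec (G r k) L → ℕ
    completions s u = #filter (λ v → allIn? S (u ++ v) ×-dec sumsTo? (u ++ v) s) (allTuples r k m)

    count≡sumBy-completions : ∀ s → count r k S (L + m) s ≡ sumBy (completions s) (allTuples r k L)
    count≡sumBy-completions s = #filter-allTuples-++ r k L m (λ xs → allIn? S xs ×-dec sumsTo? xs s)

    completions-∉ : ∀ s u → ¬ AllIn S u → completions s u ≡ 0
    completions-∉ s u u∉ = #filter-none _ (λ v uv∈ → u∉ (proj₁ (AllIn-++⁻ r k S u v (proj₁ uv∈)))) (allTuples r k m)

    completions-∈ : ∀ s u → AllIn S u → (z : G r k) → ReducesTo k (λ t → coordSum u t + toℕ (z t)) s →
      completions s u ≡ count r k S′ m z
    completions-∈ s u u∈ z u+z↦s = #filter-≐ _ (λ v → allIn? S′ v ×-dec sumsTo? v z) (to , from) (allTuples r k m)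
      where
      to : ∀ {v} → AllIn S (u ++ v) × SumsTo (u ++ v) s → AllIn S′ v × SumsTo v z
      to {v} (uv∈ , uv↦s) = proj₂ (AllIn-++⁻ r k S u v uv∈) , λ t →
        cancelˡ-ModEq (k t) _ _ (z t) (s t) (u+z↦s t) (subst (λ w → ModEq (k t) w (s t)) (coordSum-++ r k u v t) (uv↦s t))
      from : ∀ {v} → AllIn S′ v × SumsTo v z → AllIn S (u ++ v) × SumsTo (u ++ v) s
      from {v} (v∈ , v↦z) = AllIn-++⁺ r k S u v u∈ v∈ , λ t →
        subst (λ w → ModEq (k t) w (s t)) (sym (coordSum-++ r k u v t)) (+-ModEq (k t) _ _ (z t) (s t) (u+z↦s t) (v↦z t))

    completions-pinned : ∀ s u → AllIn S u × SumsTo u s → completions s u ≡ Z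
    completions-pinned s u (u∈ , u↦s) = completions-∈ s u u∈ zeroG λ t →
      subst (λ w → ModEq (k t) w (s t)) (sym (trans (cong (coordSum u t +_) (toℕ-fromℕ< (k≥1 t))) (+-identityʳ _))) (u↦s t)

    completions-count : ∀ s u → AllIn S u → Σ (G r k) λ z → completions s u ≡ count r k S′ m z
    completions-count s u u∈ = z , completions-∈ s u u∈ z (λ t → proj₂ (complement (k t) (coordSum u t) (s t)))
      where
      z : G r k
      z t = proj₁ (complement (k t) (coordSum u t) (s t))

    low≤count : ∀ s → Z + #first′ * a′ ≤ count r k S (L + m) s
    low≤count s = +-cancelʳ-≤ a′ _ _ (begin
      Z + #first′ * a′ + a′               ≡⟨ +-suc-* Z #first′ a′ ⟩
      Z + suc #first′ * a′                ≡⟨ cong (λ n → Z + n * a′) 1+#first′≡#first ⟩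
      Z + #first * a′                     ≤⟨ sumBy-pinned-≥ (allIn? S) (completions s) a′ bounded (allTuples r k L) pinned ⟩
      sumBy (completions s) (allTuples r k L) + a′ ≡⟨ cong (_+ a′) (count≡sumBy-completions s) ⟨
      count r k S (L + m) s + a′          ∎)
      where
      open ≤-Reasoning
      +-suc-* : ∀ z n a → z + n * a + a ≡ z + suc n * a
      +-suc-* = solve-∀
      bounded : ∀ u → AllIn S u → a′ ≤ completions s u
      bounded u u∈ = let z , eq = completions-count s u u∈ in subst (a′ ≤_) (sym eq) (a′≤count z)
      pinned : Any (λ u → AllIn S u × completions s u ≡ Z) (allTuples r k L)
      pinned = Any.map (λ {u} p → proj₁ p , completions-pinned s u p) (every-sum-attained S gcdS s)

    count≤low+width : ∀ s → count r k S (L + m) s ≤ Z + #first′ * a′ + #first′ * D′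
    count≤low+width s = +-cancelʳ-≤ (a′ + D′) _ _ (begin
      count r k S (L + m) s + (a′ + D′)           ≡⟨ cong (_+ (a′ + D′)) (count≡sumBy-completions s) ⟩
      sumBy (completions s) (allTuples r k L) + (a′ + D′)
        ≤⟨ sumBy-pinned-≤ (allIn? S) (completions s) (a′ + D′) bounded (completions-∉ s) (allTuples r k L) pinned ⟩
      Z + #first * (a′ + D′)                      ≡⟨ cong (λ n → Z + n * (a′ + D′)) 1+#first′≡#first ⟨
      Z + suc #first′ * (a′ + D′)                 ≡⟨ expand Z #first′ a′ D′ ⟩
      Z + #first′ * a′ + #first′ * D′ + (a′ + D′) ∎)
      where
      open ≤-Reasoning
      expand : ∀ z n a d → z + suc n * (a + d) ≡ z + n * a + n * d + (a + d)
      expand = solve-∀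
      bounded : ∀ u → AllIn S u → completions s u ≤ a′ + D′
      bounded u u∈ = let z , eq = completions-count s u u∈ in subst (_≤ a′ + D′) (sym eq) (count≤a′+D′ z)
      pinned : Any (λ u → AllIn S u × completions s u ≡ Z) (allTuples r k L)
      pinned = Any.map (λ {u} p → proj₁ p , completions-pinned s u p) (every-sum-attained S gcdS s)

    #first′≤E : #first′ ≤ E
    #first′≤E = ≤-pred (subst₂ _≤_ (sym 1+#first′≡#first) (sym 1+E≡|G|^L)
      (subst (#first ≤_) (length-allTuples r k L) (length-filter (allIn? S) (allTuples r k L))))

    width-bound : #first′ * D′ * suc P ^ (L + m) ≤ suc P ^ L * P ^ (L + m) * #AllIn r k S (L + m)
    width-bound = begin
      #first′ * D′ * suc P ^ (L + m)                      ≡⟨ cong (#first′ * D′ *_) (^-distribˡ-+-* (suc P) L m) ⟩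
      #first′ * D′ * (suc P ^ L * suc P ^ m)              ≡⟨ regroup #first′ D′ (suc P ^ L) (suc P ^ m) ⟩
      (#first′ * suc P ^ L) * (D′ * suc P ^ m)            ≤⟨ *-mono-≤ (n*[1+P]^L≤P^L*[1+n] E L #first′ #first′≤E) D′-bound ⟩
      (P ^ L * suc #first′) * (suc P ^ L * P ^ m * #AllIn r k S′ m)
        ≡⟨ regroup′ (P ^ L) (suc #first′) (suc P ^ L) (P ^ m) (#AllIn r k S′ m) ⟩
      suc P ^ L * (P ^ L * P ^ m) * (suc #first′ * #AllIn r k S′ m)
        ≡⟨ cong₂ (λ x y → suc P ^ L * x * y) (^-distribˡ-+-* P L m)
                 (trans (#AllIn-+ r k L m S) (cong (_* #AllIn r k S′ m) (sym 1+#first′≡#first))) ⟨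
      suc P ^ L * P ^ (L + m) * #AllIn r k S (L + m)      ∎
      where
      open ≤-Reasoning
      regroup : ∀ n d bl bm → n * d * (bl * bm) ≡ (n * bl) * (d * bm)
      regroup = solve-∀
      regroup′ : ∀ pl n bl pm a → (pl * n) * (bl * pm * a) ≡ bl * (pl * pm) * (n * a)
      regroup′ = solve-∀

    spread : Spread S (L + m)
    spread = record
      { low = Z + #first′ * a′
      ; width = #first′ * D′
      ; low≤count = low≤count
      ; count≤low+width = count≤low+width
      ; width-bound = width-bound
      }

  spread : ∀ m (S : Boxes) → GcdCondition S → Spread S m
  spread = <-rec (λ m → ∀ S → GcdCondition S → Spread S m) split-block
    where
    split-block : ∀ m → (∀ {m′} → m′ < m → ∀ S → GcdCondition S → Spread S m′) → ∀ S → GcdCondition S → Spread S m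
    split-block m spread< S gcdS with m <? L
    ... | yes m<L = spread-short S m m<L
    ... | no m≮L = subst (Spread S) (m+[n∸m]≡n (≮⇒≥ m≮L))
      (Step.spread S gcdS (spread< (∸-monoʳ-< L≥1 (≮⇒≥ m≮L)) (λ j → S (L + j))
                                   λ t j j≥1 → gcdS t (L + j) (≤-trans j≥1 (m≤n+m j L))))

  -- Averaging: the counts sum to #AllIn S m over the |G| targets, so each lies within the spread of the mean.
  deviation : ∀ S → GcdCondition S → ∀ m (s : G r k) → Σ ℕ λ W →
    (count r k S m s * prodFin r k ≤ prodTo m (λ j → boxSize r k (S j)) + W) ×
    (prodTo m (λ j → boxSize r k (S j)) ≤ count r k S m s * prodFin r k + W) ×
    (W * suc P ^ m ≤ prodFin r k * suc P ^ L * P ^ m * prodTo m (λ j → boxSize r k (S j)))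
  deviation S gcdS m s = width * ∏k , upper , lower , W-bound
    where
    open Spread (spread m S gcdS)
    open ≤-Reasoning
    ∏k c Y : ℕ
    ∏k = prodFin r k
    c = count r k S m s
    Y = prodTo m (λ j → boxSize r k (S j))
    #AllIn≡Y : #AllIn r k S m ≡ Y
    #AllIn≡Y = #AllIn≡prodTo r k m S
    total : sumBy (count r k S m) (allG r k) ≡ Y
    total = trans (sumBy-count≡#AllIn r k k≥1 m S) #AllIn≡Y
    |G|*low≤Y : ∏k * low ≤ Y
    |G|*low≤Y = subst₂ _≤_ (cong (_* low) |G|≡prodFin) total (length*≤sumBy (count r k S m) low low≤count (allG r k))
    Y≤|G|*[low+width] : Y ≤ ∏k * (low + width)
    Y≤|G|*[low+width] = subst₂ _≤_ total (cong (_* (low + width)) |G|≡prodFin)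
                                (sumBy≤length* (count r k S m) (low + width) count≤low+width (allG r k))
    upper : c * ∏k ≤ Y + width * ∏k
    upper = begin
      c * ∏k                         ≤⟨ *-monoˡ-≤ ∏k (count≤low+width s) ⟩
      (low + width) * ∏k             ≡⟨ *-distribʳ-+ ∏k low width ⟩
      low * ∏k + width * ∏k        ≡⟨ cong (_+ width * ∏k) (*-comm low ∏k) ⟩
      ∏k * low + width * ∏k        ≤⟨ +-monoˡ-≤ (width * ∏k) |G|*low≤Y ⟩
      Y + width * ∏k                 ∎
    lower : Y ≤ c * ∏k + width * ∏k
    lower = begin
      Y                                ≤⟨ Y≤|G|*[low+width] ⟩
      ∏k * (low + width)             ≡⟨ *-comm ∏k (low + width) ⟩
      (low + width) * ∏k             ≡⟨ *-distribʳ-+ ∏k low width ⟩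
      low * ∏k + width * ∏k        ≤⟨ +-monoˡ-≤ (width * ∏k) (*-monoˡ-≤ ∏k (low≤count s)) ⟩
      c * ∏k + width * ∏k          ∎
    W-bound : width * ∏k * suc P ^ m ≤ ∏k * suc P ^ L * P ^ m * Y
    W-bound = begin
      width * ∏k * suc P ^ m                       ≡⟨ regroup width ∏k (suc P ^ m) ⟩
      ∏k * (width * suc P ^ m)                     ≤⟨ *-monoʳ-≤ ∏k width-bound ⟩
      ∏k * (suc P ^ L * P ^ m * #AllIn r k S m)    ≡⟨ cong (λ z → ∏k * (suc P ^ L * P ^ m * z)) #AllIn≡Y ⟩
      ∏k * (suc P ^ L * P ^ m * Y)                 ≡⟨ regroup′ ∏k (suc P ^ L) (P ^ m) Y ⟩
      ∏k * suc P ^ L * P ^ m * Y                   ∎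
      where
      regroup : ∀ d g b → d * g * b ≡ g * (d * b)
      regroup = solve-∀
      regroup′ : ∀ g b p y → g * (b * p * y) ≡ g * b * p * y
      regroup′ = solve-∀

open import Data.Fin.Subset using (Subset)
open import Data.Product using (Σ; _×_; _,_)
open import Relation.Binary.PropositionalEquality using (_≡_)
open import Data.Integer using (+_)
open import Data.Rational using (ℚ; 0ℚ; 1ℚ; _<_; _≤_; _*_; _-_; ∣_∣; _/_)
open RationalBounds using (fromℕ; module Ratio)

theorem1 : (r : ℕ) (k : Fin r → ℕ) → (∀ t → k t ≥ 2) →
    (S : ℕ → (t : Fin r) → Subset (k t)) →
    (∀ (t : Fin r) (j : ℕ) → j ≥ 1 → gcdDiffs (S j t) ≡ 1) →
    (s : G r k) →
    Σ ℚ λ θ → (0ℚ < θ) × (θ < 1ℚ) ×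
      Σ ℚ λ C → Σ ℕ λ M → ∀ (m : ℕ) → m ≥ M →
        ∣ (+ (count r k S m s ℕ.* prodFin r k) / 1) - (+ prodTo m (λ j → boxSize r k (S j)) / 1) ∣
          ≤ C * (θ ^ℚ m) * (+ prodTo m (λ j → boxSize r k (S j)) / 1)
theorem1 r k k≥2 S gcdS s = θ , θ-pos P≥1 , θ<1 , fromℕ C , 0 , λ m _ →
  let W , upper , lower , W-bound = deviation S gcdS m s in
  deviation-bound _ _ W C m upper lower W-bound
  where
  open Equidistribution r k k≥2
  open Ratio P
  C : ℕ
  C = prodFin r k ℕ.* ℕ.suc P ℕ.^ L
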